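{- Let $k\ge 1$ and $n\ge 1$. Let $\tau$ be a $(k+1)$-ary increasing tree of order $n$ and let $\sigma=\Phi(\tau)$ be the $k$-Stirling permutation of order $n$ associated to it by the bijection $\Phi$ described in the context. Then \begin{align*} X_{n,j}(\sigma)&=D_{n,j+1}(\tau), && 1\le j\le k,\\ Y_{n,j}(\sigma)&=D_{n,j}(\tau), && 1\le j\le k,\\ Z_{n,j}(\sigma)&=L_{n,j+1}(\tau)=n-D_{n,j+1}(\tau), && 1\le j\le k-1, \end{align*} and consequently \[ X_n(\sigma)=n-D_{n,1}(\tau)=L_{n,1}(\tau),\qquad Y_n(\sigma)=n-D_{n,k+1}(\tau)=L_{n,k+1}(\tau),\qquad Z_n(\sigma)=\sum_{j=2}^{k}L_{n,j}(\tau). \] Furthermore, the number of blocks of $\sigma$ equals the number of left-right nodes of $\tau$: $S_n(\sigma)=LR_n(\tau)$.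
   Context: A $k$-Stirling permutation of order $n$ is a word $\sigma=a_1a_2\cdots a_{kn}$ in which each of $1,\dots,n$ occurs exactly $k$ times, such that for each $i$ every entry occurring between two occurrences of $i$ is at least $i$. Set $a_0=a_{kn+1}=0$. An index $i\in\{0,\dots,kn\}$ is an ascent if $a_i<a_{i+1}$, a descent if $a_i>a_{i+1}$, and a plateau if $a_i=a_{i+1}$; $X_n,Y_n,Z_n$ denote the total numbers of ascents, descents and plateaux. For $1\le i\le kn$: $i$ is a $j$-ascent if it is an ascent and $a_i$ is the $j$-th occurrence (from the left) of its value; $i$ is a $j$-plateau if it is a plateau and $a_i$ is the $j$-th occurrence of its value; and $i$ is a $j$-descent if $i<kn$, $i$ is a descent, and $a_{i+1}$ is the $j$-th occurrence of its value. $X_{n,j},Y_{n,j},Z_{n,j}$ denote the numbers of $j$-ascents, $j$-descents, $j$-plateaux. A block of $\sigma$ is a substring $a_p\cdots a_q$ ($p\le q$) with $a_p=a_q$ which is not contained in any strictly larger substring $a_{p'}\cdots a_{q'}$ with $a_{p'}=a_{q'}$; $S_n$ is the number of blocks. A $(k+1)$-ary increasing tree of order $n$ is a rooted tree with vertex set $\{1,\dots,n\}$, root $1$, labels increasing along every path away from the root, in which every vertex has $k+1$ positions numbered $1,\dots,k+1$ from left to right, each position being either empty or occupied by exactly one child, and each non-root vertex occupies exactly one position of its parent. $D_{n,j}(\tau)$ is the number of vertices occupying position $j$ of their parent; $L_{n,j}(\tau)$ is the number of pairs (vertex $v$, position $j$ of $v$) with that position empty. A left-right node is a vertex $v$ such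 that every non-root vertex on the path from the root to $v$ (including $v$) occupies position $1$ or position $k+1$ of its parent; the root is a left-right node. $LR_n(\tau)$ is the number of left-right nodes. The bijection $\Phi$: define $\mathrm{code}$ recursively by $\mathrm{code}(\emptyset)=$ empty word, and for a tree with root label $v$ and (possibly empty) subtrees $S_1,\dots,S_{k+1}$ in positions $1,\dots,k+1$, $\mathrm{code}=\mathrm{code}(S_1)\,v\,\mathrm{code}(S_2)\,v\cdots v\,\mathrm{code}(S_{k+1})$ (the $k$ copies of $v$ separating the $k+1$ codes). $\Phi(\tau)=\mathrm{code}(\tau)$; this is a bijection from $(k+1)$-ary increasing trees of order $n$ onto $k$-Stirling permutations of order $n$. -}

module Defs where

open import Data.Nat.Base using (ℕ; zero; suc; _+_; _∸_; _<ᵇ_; _≡ᵇ_; _<_)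
open import Data.Bool.Base using (Bool; true; false; if_then_else_; _∧_; _∨_; not)
open import Data.List.Base using (List; []; _∷_; _++_; map; length; upTo; take)
open import Data.Nat.ListAction using (sum)
open import Data.Bool.ListAction using (all; any)
open import Data.List.Relation.Unary.All using (All)
open import Data.List.Relation.Binary.Permutation.Propositional using (_↭_)
open import Data.Vec.Base using (Vec; []; _∷_)
open import Data.Product.Base using (_×_; _,_)

countB : {A : Set} → (A → Bool) → List A → ℕ
countB f [] = 0
countB f (x ∷ xs) = (if f x then 1 else 0) + countB f xs

-- the integers lo, lo+1, ..., hi  (empty if hi < lo)
range : ℕ → ℕ → List ℕ
range lo hi = map (lo +_) (upTo (suc hi ∸ lo))

-- Words: σ = a₁ ⋯ a_m given as a list, with a₀ = a_{m+1} = 0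

-- at σ i = a_i (1-indexed), with a₀ = 0 and a_i = 0 for i > length σ
at : List ℕ → ℕ → ℕ
at σ zero = 0
at [] (suc i) = 0
at (x ∷ σ) (suc zero) = x
at (x ∷ σ) (suc (suc i)) = at σ (suc i)

-- occ σ i = r  iff  a_i is the r-th occurrence (from the left) of its value
occ : List ℕ → ℕ → ℕ
occ σ i = countB (λ x → x ≡ᵇ at σ i) (take i σ)

isAsc isDesc isPlat : List ℕ → ℕ → Bool
isAsc σ i = at σ i <ᵇ at σ (suc i)
isDesc σ i = at σ (suc i) <ᵇ at σ i
isPlat σ i = at σ i ≡ᵇ at σ (suc i)

Xn Yn Zn : List ℕ → ℕ
Xn σ = countB (isAsc σ) (range 0 (length σ))
Yn σ = countB (isDesc σ) (range 0 (length σ))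
Zn σ = countB (isPlat σ) (range 0 (length σ))

Xnj Ynj Znj : List ℕ → ℕ → ℕ
Xnj σ j = countB (λ i → isAsc σ i ∧ (occ σ i ≡ᵇ j)) (range 1 (length σ))
Ynj σ j = countB (λ i → (i <ᵇ length σ) ∧ isDesc σ i ∧ (occ σ (suc i) ≡ᵇ j))
                 (range 1 (length σ))
Znj σ j = countB (λ i → isPlat σ i ∧ (occ σ i ≡ᵇ j)) (range 1 (length σ))

isClosed : List ℕ → ℕ → ℕ → Bool
isClosed σ p q = at σ p ≡ᵇ at σ q

-- (p , q) is a block: a_p ⋯ a_q with a_p = a_q, not contained in a strictly
-- larger substring a_p' ⋯ a_q' with a_p' = a_q'
isBlock : List ℕ → ℕ → ℕ → Bool
isBlock σ p q =
  isClosed σ p q ∧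
  not (any (λ p' → any (λ q' → isClosed σ p' q' ∧ ((p' <ᵇ p) ∨ (q <ᵇ q')))
                        (range q (length σ)))
           (range 1 p))

Sn : List ℕ → ℕ
Sn σ = sum (map (λ p → countB (isBlock σ p) (range p (length σ)))
                (range 1 (length σ)))

-- (k+1)-ary trees: every vertex has k+1 positions, each empty (leaf) or
-- occupied by a subtree.

data Tree (k : ℕ) : Set where
  leaf : Tree k
  node : ℕ → Vec (Tree k) (suc k) → Tree k

-- a vertex record: (path of positions from the root, label, its k+1 positions)
Vertex : ℕ → Set
Vertex k = List ℕ × ℕ × Vec (Tree k) (suc k)

prepend : {k : ℕ} → ℕ → Vertex k → Vertex k
prepend i (p , v , cs) = (i ∷ p , v , cs)

mutual
  -- all vertices of a tree, with the list of positions (numbered 1..k+1)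
  -- taken on the path from the root
  vertices : {k : ℕ} → Tree k → List (Vertex k)
  vertices leaf = []
  vertices (node v cs) = ([] , v , cs) ∷ verticesV 1 cs

  verticesV : {k m : ℕ} → ℕ → Vec (Tree k) m → List (Vertex k)
  verticesV i [] = []
  verticesV i (t ∷ ts) = map (prepend i) (vertices t) ++ verticesV (suc i) ts

label : {k : ℕ} → Vertex k → ℕ
label (p , v , cs) = v

labels : {k : ℕ} → Tree k → List ℕ
labels t = map label (vertices t)

rootLabel : {k : ℕ} → Tree k → ℕ
rootLabel leaf = 0
rootLabel (node v cs) = v

childLabels : {k m : ℕ} → Vec (Tree k) m → List ℕ
childLabels [] = []
childLabels (leaf ∷ ts) = childLabels ts
childLabels (node v _ ∷ ts) = v ∷ childLabels ts

IsIncreasingTree : (k n : ℕ) → Tree k → Set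
IsIncreasingTree k n t =
  (labels t ↭ range 1 n) ×
  (rootLabel t ≡′ 1) ×
  All (λ x → let (p , v , cs) = x in All (v <_) (childLabels cs)) (vertices t)
  where
  open import Relation.Binary.PropositionalEquality using () renaming (_≡_ to _≡′_)

-- is position j (1-indexed) of this vector empty?  (false if j out of range)
emptyAt : {k m : ℕ} → ℕ → Vec (Tree k) m → Bool
emptyAt j [] = false
emptyAt zero (t ∷ ts) = false
emptyAt (suc zero) (leaf ∷ ts) = true
emptyAt (suc zero) (node _ _ ∷ ts) = false
emptyAt (suc (suc j)) (t ∷ ts) = emptyAt (suc j) ts

lastPos : List ℕ → ℕ
lastPos [] = 0
lastPos (x ∷ []) = x
lastPos (x ∷ y ∷ p) = lastPos (y ∷ p)

-- D_{n,j}: number of vertices occupying position j of their parent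
D : {k : ℕ} → Tree k → ℕ → ℕ
D t j = countB (λ x → let (p , v , cs) = x in lastPos p ≡ᵇ j) (vertices t)
  -- the root has empty path, lastPos = 0, never counted since j ≥ 1

L : {k : ℕ} → Tree k → ℕ → ℕ
L t j = countB (λ x → let (p , v , cs) = x in emptyAt j cs) (vertices t)

LR : {k : ℕ} → Tree k → ℕ
LR {k} t = countB (λ x → let (p , v , cs) = x in
                          all (λ i → (i ≡ᵇ 1) ∨ (i ≡ᵇ suc k)) p)
                  (vertices t)

mutual
  code : {k : ℕ} → Tree k → List ℕ
  code leaf = []
  code (node v (c ∷ cs)) = code c ++ codeV v cs

  codeV : {k m : ℕ} → ℕ → Vec (Tree k) m → List ℕ
  codeV v [] = []
  codeV v (c ∷ cs) = v ∷ code c ++ codeV v cs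

Φ : {k : ℕ} → Tree k → List ℕ
Φ = code

module Submission where

-- Key observation: when the labels of τ are distinct, the copy of a vertex v
-- written between the codes of its j-th and (j+1)-th subtrees is the j-th
-- occurrence of v in σ.  Hence σ annotated with occurrence numbers is given by
-- a structural recursion on τ (annFrom-code), and every statistic of σ is a
-- count of adjacent annotated pairs (pairs-annFrom).  Since τ is increasing,
-- the letter following code t is smaller than every label of t, so each pair
-- v_j · (next letter) is an ascent, descent or plateau according to whether
-- position j+1 of v is occupied, and so on.  For blocks: the block count
-- is additive over words with no common letter (blocks-++), a word with equal
-- first and last letter has a single block, and
--   code (node v S) = code S₁ · (v code S₂ v ⋯ code S_k v) · code S_{k+1},
-- so blocks come from the outer subtrees exactly as left-right nodes do.

open import Defs
open import Function.Base using (_∘_; const)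
open import Function.Bundles using (Equivalence)
open import Data.Nat.Base
  using (ℕ; zero; suc; _+_; _∸_; _<ᵇ_; _≡ᵇ_; _≤_; _<_; z≤n; s≤s; s≤s⁻¹)
open import Data.Nat.Properties
open import Data.Bool.Base using (Bool; true; false; if_then_else_; _∧_; _∨_; not)
open import Data.Bool.Properties using (T-≡; ∧-zeroʳ; ∧-identityʳ; ∨-identityʳ)
open import Data.Bool.ListAction using (all; any)
open import Data.List.Base
  using (List; []; _∷_; _++_; map; length; applyUpTo; _ʳ++_)
open import Data.List.Properties
  using (map-++; map-cong; map-cong-local; map-∘; map-upTo; length-++; length-map;
         ++-assoc; ++-identityʳ; take-all)
open import Data.Nat.ListAction using (sum)
open import Data.Nat.ListAction.Properties using (sum-++; sum-↭)
open import Data.List.Relation.Unary.All using (All; []; _∷_; tabulate)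
import Data.List.Relation.Unary.All.Properties as All
open import Data.List.Relation.Binary.Permutation.Propositional using (_↭_)
open import Data.List.Relation.Binary.Permutation.Propositional.Properties
  using (↭-length; map⁺)
open import Data.Vec.Base using (Vec; []; _∷_)
open import Data.Product.Base using (_×_; _,_; proj₁; proj₂; ∃)
open import Data.Sum.Base using (_⊎_; inj₁; inj₂)
open import Data.Empty using (⊥; ⊥-elim)
open import Data.Unit.Base using (⊤; tt)
open import Relation.Binary.PropositionalEquality
open import Data.Nat.Tactic.RingSolver using (solve-∀)
open import Algebra.Properties.CommutativeSemigroup +-commutativeSemigroup
  using (interchange; x∙yz≈y∙xz; x∙yz≈yx∙z; xy∙z≈y∙xz)

ind : Bool → ℕ
ind b = if b then 1 else 0

countB-as-sum : {A : Set} (f : A → Bool) (xs : List A) →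
  countB f xs ≡ sum (map (ind ∘ f) xs)
countB-as-sum f [] = refl
countB-as-sum f (x ∷ xs) = cong (ind (f x) +_) (countB-as-sum f xs)

countB-++ : {A : Set} (f : A → Bool) (xs ys : List A) →
  countB f (xs ++ ys) ≡ countB f xs + countB f ys
countB-++ f [] ys = refl
countB-++ f (x ∷ xs) ys =
  trans (cong (ind (f x) +_) (countB-++ f xs ys)) (sym (+-assoc (ind (f x)) _ _))

countB-map : {A B : Set} (f : B → Bool) (g : A → B) (xs : List A) →
  countB f (map g xs) ≡ countB (f ∘ g) xs
countB-map f g [] = refl
countB-map f g (x ∷ xs) = cong (ind (f (g x)) +_) (countB-map f g xs)

countB-↭ : {A : Set} (f : A → Bool) {xs ys : List A} → xs ↭ ys →
  countB f xs ≡ countB f ys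
countB-↭ f {xs} {ys} p =
  trans (countB-as-sum f xs) (trans (sum-↭ (map⁺ (ind ∘ f) p)) (sym (countB-as-sum f ys)))

countB-cong-local : {A : Set} {f g : A → Bool} (xs : List A) →
  All (λ x → f x ≡ g x) xs → countB f xs ≡ countB g xs
countB-cong-local [] [] = refl
countB-cong-local (x ∷ xs) (e ∷ es) = cong₂ (λ b n → ind b + n) e (countB-cong-local xs es)

countB-none : {A : Set} {f : A → Bool} (xs : List A) →
  All (λ x → f x ≡ false) xs → countB f xs ≡ 0
countB-none [] [] = refl
countB-none (x ∷ xs) (e ∷ es) rewrite e = countB-none xs es

<ᵇ-true : ∀ {m n} → m < n → (m <ᵇ n) ≡ true
<ᵇ-true m<n = Equivalence.to T-≡ (<⇒<ᵇ m<n)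

<ᵇ-false : ∀ {m n} → n ≤ m → (m <ᵇ n) ≡ false
<ᵇ-false {m} {zero} _ = refl
<ᵇ-false {suc m} {suc n} (s≤s n≤m) = <ᵇ-false n≤m

<ᵇ-irrefl : ∀ m → (m <ᵇ m) ≡ false
<ᵇ-irrefl m = <ᵇ-false {m} ≤-refl

+-<ᵇ : ∀ a x y → (a + x <ᵇ a + y) ≡ (x <ᵇ y)
+-<ᵇ zero x y = refl
+-<ᵇ (suc a) x y = +-<ᵇ a x y

≡ᵇ-refl : ∀ m → (m ≡ᵇ m) ≡ true
≡ᵇ-refl m = Equivalence.to T-≡ (≡⇒≡ᵇ m m refl)

≡ᵇ-sound : ∀ m n → (m ≡ᵇ n) ≡ true → m ≡ n
≡ᵇ-sound m n e = ≡ᵇ⇒≡ m n (Equivalence.from T-≡ e)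

≡ᵇ-false : ∀ m n → (m ≡ n → ⊥) → (m ≡ᵇ n) ≡ false
≡ᵇ-false m n m≢n with m ≡ᵇ n in eq
... | true = ⊥-elim (m≢n (≡ᵇ-sound m n eq))
... | false = refl

≡ᵇ-false-< : ∀ {a b} → a < b → (a ≡ᵇ b) ≡ false
≡ᵇ-false-< {a} {b} a<b = ≡ᵇ-false a b (λ e → <-irrefl e a<b)

≡ᵇ-false-> : ∀ {a b} → b < a → (a ≡ᵇ b) ≡ false
≡ᵇ-false-> {a} {b} b<a = ≡ᵇ-false a b (λ e → <-irrefl (sym e) b<a)

∧-false-l : ∀ {x y : Bool} → x ≡ false → (x ∧ y) ≡ false
∧-false-l refl = refl

any-++ : {A : Set} (f : A → Bool) (xs ys : List A) →
  any f (xs ++ ys) ≡ (any f xs ∨ any f ys)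
any-++ f [] ys = refl
any-++ f (x ∷ xs) ys with f x
... | true = refl
... | false = any-++ f xs ys

any-map : {A B : Set} (f : B → Bool) (g : A → B) (xs : List A) →
  any f (map g xs) ≡ any (f ∘ g) xs
any-map f g [] = refl
any-map f g (x ∷ xs) = cong (f (g x) ∨_) (any-map f g xs)

any-cong-local : {A : Set} {f g : A → Bool} (xs : List A) →
  All (λ x → f x ≡ g x) xs → any f xs ≡ any g xs
any-cong-local [] [] = refl
any-cong-local (x ∷ xs) (e ∷ es) = cong₂ _∨_ e (any-cong-local xs es)

any-none : {A : Set} {f : A → Bool} (xs : List A) →
  All (λ x → f x ≡ false) xs → any f xs ≡ false
any-none [] [] = refl
any-none (x ∷ xs) (e ∷ es) rewrite e = any-none xs es

sum-map-++ : {A : Set} (f : A → ℕ) (xs ys : List A) →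
  sum (map f (xs ++ ys)) ≡ sum (map f xs) + sum (map f ys)
sum-map-++ f xs ys = trans (cong sum (map-++ f xs ys)) (sum-++ (map f xs) (map f ys))

sum-map-+ : {A : Set} (f g : A → ℕ) (xs : List A) →
  sum (map (λ x → f x + g x) xs) ≡ sum (map f xs) + sum (map g xs)
sum-map-+ f g [] = refl
sum-map-+ f g (x ∷ xs) =
  trans (cong (f x + g x +_) (sum-map-+ f g xs))
        (interchange (f x) (g x) (sum (map f xs)) (sum (map g xs)))

sum-map-0 : {A : Set} (xs : List A) → sum (map (const 0) xs) ≡ 0
sum-map-0 [] = refl
sum-map-0 (x ∷ xs) = sum-map-0 xs

interval : ℕ → ℕ → List ℕ
interval lo zero = []
interval lo (suc d) = lo ∷ interval (suc lo) d

applyUpTo-interval : ∀ (f : ℕ → ℕ) lo d → (∀ x → f x ≡ lo + x) → applyUpTo f d ≡ interval lo d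
applyUpTo-interval f lo zero e = refl
applyUpTo-interval f lo (suc d) e =
  cong₂ _∷_ (trans (e 0) (+-identityʳ lo))
    (applyUpTo-interval (f ∘ suc) (suc lo) d (λ x → trans (e (suc x)) (+-suc lo x)))

range≡interval : ∀ lo hi → range lo hi ≡ interval lo (suc hi ∸ lo)
range≡interval lo hi =
  trans (map-upTo (lo +_) (suc hi ∸ lo)) (applyUpTo-interval (lo +_) lo _ (λ x → refl))

interval-+ : ∀ lo d e → interval lo (d + e) ≡ interval lo d ++ interval (d + lo) e
interval-+ lo zero e = refl
interval-+ lo (suc d) e =
  cong (lo ∷_) (trans (interval-+ (suc lo) d e) (cong (λ z → interval (suc lo) d ++ interval z e) (+-suc d lo)))

interval-shift : ∀ a lo d → map (a +_) (interval lo d) ≡ interval (a + lo) d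
interval-shift a lo zero = refl
interval-shift a lo (suc d) =
  cong (a + lo ∷_) (trans (interval-shift a (suc lo) d) (cong (λ z → interval z d) (+-suc a lo)))

interval-snoc : ∀ lo d → interval lo (suc d) ≡ interval lo d ++ (lo + d ∷ [])
interval-snoc lo zero = cong (_∷ []) (sym (+-identityʳ lo))
interval-snoc lo (suc d) =
  cong (lo ∷_) (trans (interval-snoc (suc lo) d) (cong (λ z → interval (suc lo) d ++ (z ∷ [])) (sym (+-suc lo d))))

interval-length : ∀ lo d → length (interval lo d) ≡ d
interval-length lo zero = refl
interval-length lo (suc d) = cong suc (interval-length (suc lo) d)

interval-All : ∀ {P : ℕ → Set} lo d → (∀ x → lo ≤ x → x < lo + d → P x) → All P (interval lo d)
interval-All lo zero h = []
interval-All lo (suc d) h =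
  h lo ≤-refl (subst (lo <_) (sym (+-suc lo d)) (s≤s (m≤m+n lo d))) ∷
  interval-All (suc lo) d (λ x l u → h x (<⇒≤ l) (subst (x <_) (sym (+-suc lo d)) u))

any-interval : ∀ (f : ℕ → Bool) lo d x → lo ≤ x → x < lo + d → f x ≡ true → any f (interval lo d) ≡ true
any-interval f lo zero x l u e = ⊥-elim (<-irrefl refl (≤-trans u (subst (_≤ x) (sym (+-identityʳ lo)) l)))
any-interval f lo (suc d) x l u e with f lo in eq
... | true = refl
... | false with m≤n⇒m<n∨m≡n l
...   | inj₂ refl = ⊥-elim (subst (λ b → b ≡ true → ⊥) (sym eq) (λ ()) e)
...   | inj₁ lo<x = any-interval f (suc lo) d x lo<x (subst (x <_) (+-suc lo d) u) e

range-bound : ∀ lo hi x → lo ≤ x → x < lo + (suc hi ∸ lo) → x ≤ hi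
range-bound zero hi x l u = ≤-pred u
range-bound (suc lo) zero x l u =
  ⊥-elim (<-irrefl refl (≤-trans u (subst (_≤ x) (sym (trans (cong (suc lo +_) (0∸n≡0 lo)) (+-identityʳ (suc lo)))) l)))
range-bound (suc lo) (suc hi) (suc x) (s≤s l) (s≤s u) = s≤s (range-bound lo hi x l u)

range-All : ∀ {P : ℕ → Set} lo hi → (∀ x → lo ≤ x → x ≤ hi → P x) → All P (range lo hi)
range-All {P} lo hi h =
  subst (All P) (sym (range≡interval lo hi))
    (interval-All lo (suc hi ∸ lo) (λ x l u → h x l (range-bound lo hi x l u)))

range-one : ∀ m → range 1 m ≡ interval 1 m
range-one m = range≡interval 1 m

range-split : ∀ p a b → p ≤ suc a → range p (a + b) ≡ range p a ++ interval (suc a) b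
range-split p a b p≤1+a =
  trans (range≡interval p (a + b))
  (trans (cong (interval p) (+-∸-comm b p≤1+a))
  (trans (interval-+ p (suc a ∸ p) b)
  (cong₂ _++_ (sym (range≡interval p a)) (cong (λ z → interval z b) (m∸n+n≡m p≤1+a)))))

range-shift : ∀ a p b → range (a + p) (a + b) ≡ map (a +_) (range p b)
range-shift a p b =
  trans (range≡interval (a + p) (a + b))
  (trans (cong (λ z → interval (a + p) (z ∸ (a + p))) (sym (+-suc a b)))
  (trans (cong (interval (a + p)) ([m+n]∸[m+o]≡n∸o a (suc b) p))
  (trans (sym (interval-shift a p (suc b ∸ p))) (cong (map (a +_)) (sym (range≡interval p b))))))

cnt : ℕ → List ℕ → ℕ
cnt y = countB (λ x → x ≡ᵇ y)

cnt-++ : ∀ y A B → cnt y (A ++ B) ≡ cnt y A + cnt y B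
cnt-++ y = countB-++ (λ x → x ≡ᵇ y)

cnt-ʳ++ : ∀ y A B → cnt y (A ʳ++ B) ≡ cnt y A + cnt y B
cnt-ʳ++ y [] B = refl
cnt-ʳ++ y (x ∷ A) B =
  trans (cnt-ʳ++ y A (x ∷ B)) (sym (xy∙z≈y∙xz (ind (x ≡ᵇ y)) (cnt y A) (cnt y B)))

cnt-++-0 : ∀ y A B → cnt y A ≡ 0 → cnt y B ≡ 0 → cnt y (A ++ B) ≡ 0
cnt-++-0 y A B a b = trans (cnt-++ y A B) (cong₂ _+_ a b)

cnt-++-0ˡ : ∀ y A B → cnt y (A ++ B) ≡ 0 → cnt y A ≡ 0
cnt-++-0ˡ y A B e = m+n≡0⇒m≡0 (cnt y A) (trans (sym (cnt-++ y A B)) e)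

cnt-++-0ʳ : ∀ y A B → cnt y (A ++ B) ≡ 0 → cnt y B ≡ 0
cnt-++-0ʳ y A B e = m+n≡0⇒n≡0 (cnt y A) (trans (sym (cnt-++ y A B)) e)

cnt-head : ∀ x A → cnt x (x ∷ A) ≡ suc (cnt x A)
cnt-head x A = cong (λ b → ind b + cnt x A) (≡ᵇ-refl x)

cnt-0-≢ : ∀ x y A → cnt x A ≡ 0 → cnt y A ≡ 0 ⊎ (x ≡ᵇ y) ≡ false
cnt-0-≢ x y A e with x ≡ᵇ y in eq
... | false = inj₂ refl
... | true rewrite ≡ᵇ-sound x y eq = inj₁ e

Distinct : List ℕ → Set
Distinct l = ∀ y → cnt y l ≤ 1

Disjoint : List ℕ → List ℕ → Set
Disjoint A B = ∀ y → cnt y A ≡ 0 ⊎ cnt y B ≡ 0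

distinct-++ˡ : ∀ A B → Distinct (A ++ B) → Distinct A
distinct-++ˡ A B d y = ≤-trans (subst (cnt y A ≤_) (sym (cnt-++ y A B)) (m≤m+n _ _)) (d y)

distinct-++ʳ : ∀ A B → Distinct (A ++ B) → Distinct B
distinct-++ʳ A B d y = ≤-trans (subst (cnt y B ≤_) (sym (cnt-++ y A B)) (m≤n+m _ _)) (d y)

distinct-tail : ∀ x A → Distinct (x ∷ A) → Distinct A
distinct-tail x A d y = ≤-trans (m≤n+m (cnt y A) (ind (x ≡ᵇ y))) (d y)

distinct-head : ∀ x A → Distinct (x ∷ A) → cnt x A ≡ 0
distinct-head x A d = n≤0⇒n≡0 (s≤s⁻¹ (subst (_≤ 1) (cnt-head x A) (d x)))

distinct-++⇒disjoint : ∀ A B → Distinct (A ++ B) → Disjoint A B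
distinct-++⇒disjoint A B d y with cnt y A in ea | cnt y B in eb
... | zero | _ = inj₁ refl
... | _ | zero = inj₂ refl
... | suc a | suc b =
  ⊥-elim (<-irrefl refl (≤-trans (subst (2 ≤_) (sym (trans (cnt-++ y A B) (cong₂ _+_ ea eb)))
                                          (s≤s (subst (1 ≤_) (sym (+-suc a b)) (s≤s z≤n))))
                                 (d y)))

disjoint-sym : ∀ A B → Disjoint A B → Disjoint B A
disjoint-sym A B s y with s y
... | inj₁ e = inj₂ e
... | inj₂ e = inj₁ e

disjoint-++ˡ⁻ : ∀ A B P → Disjoint (A ++ B) P → Disjoint A P
disjoint-++ˡ⁻ A B P s y with s y
... | inj₁ e = inj₁ (cnt-++-0ˡ y A B e)
... | inj₂ e = inj₂ e

disjoint-++ʳ⁻ : ∀ A B P → Disjoint (A ++ B) P → Disjoint B P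
disjoint-++ʳ⁻ A B P s y with s y
... | inj₁ e = inj₁ (cnt-++-0ʳ y A B e)
... | inj₂ e = inj₂ e

disjoint-∷⁻ : ∀ x A P → Disjoint (x ∷ A) P → Disjoint A P
disjoint-∷⁻ x A P s y with s y
... | inj₁ e = inj₁ (m+n≡0⇒n≡0 (ind (x ≡ᵇ y)) e)
... | inj₂ e = inj₂ e

disjoint-head : ∀ x A P → Disjoint (x ∷ A) P → cnt x P ≡ 0
disjoint-head x A P s with s x
... | inj₁ e = ⊥-elim (1+n≢0 (trans (sym (cnt-head x A)) e))
... | inj₂ e = e

disjoint-∷ : ∀ x A P → cnt x A ≡ 0 → Disjoint A P → Disjoint A (x ∷ P)
disjoint-∷ x A P x∉A s y with s y | cnt-0-≢ x y A x∉A
... | inj₁ e | _ = inj₁ e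
... | inj₂ _ | inj₁ e = inj₁ e
... | inj₂ e | inj₂ x≢y = inj₂ (trans (cong (λ b → ind b + cnt y P) x≢y) e)

disjoint-ʳ++ : ∀ A B C → Disjoint A B → Disjoint A C → Disjoint A (B ʳ++ C)
disjoint-ʳ++ A B C sB sC y with sB y | sC y
... | inj₁ e | _ = inj₁ e
... | inj₂ _ | inj₁ e = inj₁ e
... | inj₂ eB | inj₂ eC = inj₂ (trans (cnt-ʳ++ y B C) (cong₂ _+_ eB eC))

mutual
  lbl : {k : ℕ} → Tree k → List ℕ
  lbl leaf = []
  lbl (node v cs) = v ∷ lblV cs

  lblV : {k m : ℕ} → Vec (Tree k) m → List ℕ
  lblV [] = []
  lblV (c ∷ cs) = lbl c ++ lblV cs

label-prepend : {k : ℕ} (i : ℕ) (xs : List (Vertex k)) → map label (map (prepend i) xs) ≡ map label xs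
label-prepend i xs = sym (map-∘ xs)

mutual
  labels≡lbl : {k : ℕ} (t : Tree k) → labels t ≡ lbl t
  labels≡lbl leaf = refl
  labels≡lbl (node v cs) = cong (v ∷_) (labelsV≡lblV 1 cs)

  labelsV≡lblV : {k m : ℕ} (i : ℕ) (cs : Vec (Tree k) m) → map label (verticesV i cs) ≡ lblV cs
  labelsV≡lblV i [] = refl
  labelsV≡lblV i (c ∷ cs) =
    trans (map-++ label (map (prepend i) (vertices c)) (verticesV (suc i) cs))
      (cong₂ _++_ (trans (label-prepend i (vertices c)) (labels≡lbl c)) (labelsV≡lblV (suc i) cs))

mutual
  code-0 : {k : ℕ} (y : ℕ) (t : Tree k) → cnt y (lbl t) ≡ 0 → cnt y (code t) ≡ 0
  code-0 y leaf e = refl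
  code-0 y (node v (c ∷ cs)) e =
    cnt-++-0 y (code c) (codeV v cs)
      (code-0 y c (cnt-++-0ˡ y (lbl c) (lblV cs) rest))
      (codeV-0 y v cs (m+n≡0⇒m≡0 (ind (v ≡ᵇ y)) e) (cnt-++-0ʳ y (lbl c) (lblV cs) rest))
    where
    rest = m+n≡0⇒n≡0 (ind (v ≡ᵇ y)) e

  codeV-0 : {k m : ℕ} (y v : ℕ) (cs : Vec (Tree k) m) →
    ind (v ≡ᵇ y) ≡ 0 → cnt y (lblV cs) ≡ 0 → cnt y (codeV v cs) ≡ 0
  codeV-0 y v [] ev e = refl
  codeV-0 y v (c ∷ cs) ev e =
    trans (cong (_+ cnt y (code c ++ codeV v cs)) ev)
      (cnt-++-0 y (code c) (codeV v cs)
        (code-0 y c (cnt-++-0ˡ y (lbl c) (lblV cs) e))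
        (codeV-0 y v cs ev (cnt-++-0ʳ y (lbl c) (lblV cs) e)))

disjoint-code : ∀ {k} A (t : Tree k) → Disjoint A (lbl t) → Disjoint A (code t)
disjoint-code A t s y with s y
... | inj₁ e = inj₁ e
... | inj₂ e = inj₂ (code-0 y t e)

-- a letter together with its occurrence number
Ann : Set
Ann = ℕ × ℕ

-- annFrom pre w annotates each letter of w with its occurrence number,
-- counting also the occurrences in the (reversed) prefix pre
annFrom : List ℕ → List ℕ → List Ann
annFrom pre [] = []
annFrom pre (x ∷ xs) = (x , cnt x pre + 1) ∷ annFrom (x ∷ pre) xs

annFrom-++ : ∀ pre u w → annFrom pre (u ++ w) ≡ annFrom pre u ++ annFrom (u ʳ++ pre) w
annFrom-++ pre [] w = refl
annFrom-++ pre (x ∷ u) w = cong ((x , cnt x pre + 1) ∷_) (annFrom-++ (x ∷ pre) u w)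

mutual
  -- the annotation of code t read off the tree: the copy of v between
  -- the codes of the j-th and (j+1)-th subtrees is its j-th occurrence
  annCode : {k : ℕ} → Tree k → List Ann
  annCode leaf = []
  annCode (node v (c ∷ cs)) = annCode c ++ annV v 1 cs

  annV : {k m : ℕ} → ℕ → ℕ → Vec (Tree k) m → List Ann
  annV v j [] = []
  annV v j (c ∷ cs) = (v , j) ∷ annCode c ++ annV v (suc j) cs

mutual
  annFrom-code : {k : ℕ} (t : Tree k) (pre : List ℕ) →
    Distinct (lbl t) → Disjoint (lbl t) pre → annFrom pre (code t) ≡ annCode t
  annFrom-code leaf pre d s = refl
  annFrom-code (node v (c ∷ cs)) pre d s =
    trans (annFrom-++ pre (code c) (codeV v cs))
      (cong₂ _++_ (annFrom-code c pre dc (disjoint-++ˡ⁻ (lbl c) (lblV cs) pre s-below))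
                  (annFrom-codeV v 1 cs (code c ʳ++ pre) dV v∉V sV first))
    where
    d-below = distinct-tail v (lbl c ++ lblV cs) d
    dc = distinct-++ˡ (lbl c) (lblV cs) d-below
    dV = distinct-++ʳ (lbl c) (lblV cs) d-below
    v∉ = distinct-head v (lbl c ++ lblV cs) d
    v∉V = cnt-++-0ʳ v (lbl c) (lblV cs) v∉
    s-below = disjoint-∷⁻ v (lbl c ++ lblV cs) pre s
    sV : Disjoint (lblV cs) (code c ʳ++ pre)
    sV = disjoint-ʳ++ (lblV cs) (code c) pre
           (disjoint-code (lblV cs) c (disjoint-sym (lbl c) (lblV cs) (distinct-++⇒disjoint (lbl c) (lblV cs) d-below)))
           (disjoint-++ʳ⁻ (lbl c) (lblV cs) pre s-below)
    first : cnt v (code c ʳ++ pre) + 1 ≡ 1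
    first = cong (_+ 1) (trans (cnt-ʳ++ v (code c) pre)
              (cong₂ _+_ (code-0 v c (cnt-++-0ˡ v (lbl c) (lblV cs) v∉))
                         (disjoint-head v (lbl c ++ lblV cs) pre s)))

  annFrom-codeV : {k m : ℕ} (v j : ℕ) (cs : Vec (Tree k) m) (P : List ℕ) →
    Distinct (lblV cs) → cnt v (lblV cs) ≡ 0 → Disjoint (lblV cs) P → cnt v P + 1 ≡ j →
    annFrom P (codeV v cs) ≡ annV v j cs
  annFrom-codeV v j [] P d v∉ s e = refl
  annFrom-codeV v j (c ∷ cs) P d v∉ s refl =
    cong ((v , cnt v P + 1) ∷_) (trans (annFrom-++ (v ∷ P) (code c) (codeV v cs))
      (cong₂ _++_ (annFrom-code c (v ∷ P) dc sc)
                  (annFrom-codeV v (suc (cnt v P + 1)) cs (code c ʳ++ (v ∷ P)) dV v∉V sV next)))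
    where
    dc = distinct-++ˡ (lbl c) (lblV cs) d
    dV = distinct-++ʳ (lbl c) (lblV cs) d
    v∉c = cnt-++-0ˡ v (lbl c) (lblV cs) v∉
    v∉V = cnt-++-0ʳ v (lbl c) (lblV cs) v∉
    sc : Disjoint (lbl c) (v ∷ P)
    sc = disjoint-∷ v (lbl c) P v∉c (disjoint-++ˡ⁻ (lbl c) (lblV cs) P s)
    sV : Disjoint (lblV cs) (code c ʳ++ (v ∷ P))
    sV = disjoint-ʳ++ (lblV cs) (code c) (v ∷ P)
           (disjoint-code (lblV cs) c (disjoint-sym (lbl c) (lblV cs) (distinct-++⇒disjoint (lbl c) (lblV cs) d)))
           (disjoint-∷ v (lblV cs) P v∉V (disjoint-++ʳ⁻ (lbl c) (lblV cs) P s))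
    next : cnt v (code c ʳ++ (v ∷ P)) + 1 ≡ suc (cnt v P + 1)
    next = cong (_+ 1) (trans (cnt-ʳ++ v (code c) (v ∷ P))
             (cong₂ _+_ (code-0 v c v∉c) (cnt-head v P)))

headOr : List Ann → Ann → Ann
headOr [] s = s
headOr (y ∷ _) s = y

adjacent : List Ann → Ann → List (Ann × Ann)
adjacent [] s = []
adjacent (x ∷ xs) s = (x , headOr xs s) ∷ adjacent xs s

headOr-++ : ∀ u w s → headOr (u ++ w) s ≡ headOr u (headOr w s)
headOr-++ [] w s = refl
headOr-++ (x ∷ u) w s = refl

adjacent-++ : ∀ u w s → adjacent (u ++ w) s ≡ adjacent u (headOr w s) ++ adjacent w s
adjacent-++ [] w s = refl
adjacent-++ (x ∷ u) w s = cong₂ (λ h r → (x , h) ∷ r) (headOr-++ u w s) (adjacent-++ u w s)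

pairAt : List ℕ → List ℕ → ℕ → Ann × Ann
pairAt pre σ i = ((at σ i , cnt (at σ i) pre + occ σ i) ,
                  (at σ (suc i) , cnt (at σ (suc i)) pre + occ σ (suc i)))

pairAt-tail : ∀ pre x σ i → 1 ≤ i → pairAt pre (x ∷ σ) (suc i) ≡ pairAt (x ∷ pre) σ i
pairAt-tail pre x σ (suc i) _ = cong₂ _,_
  (cong (at σ (suc i) ,_) (x∙yz≈yx∙z (cnt (at σ (suc i)) pre) _ (occ σ (suc i))))
  (cong (at σ (suc (suc i)) ,_) (x∙yz≈yx∙z (cnt (at σ (suc (suc i))) pre) _ (occ σ (suc (suc i)))))

pairAt-head : ∀ pre x σ →
  pairAt pre (x ∷ σ) 1 ≡ ((x , cnt x pre + 1) , headOr (annFrom (x ∷ pre) σ) (0 , cnt 0 pre + cnt 0 (x ∷ σ)))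
pairAt-head pre x [] = cong (λ b → ((x , cnt x pre + (ind b + 0)) , (0 , cnt 0 pre + (ind (x ≡ᵇ 0) + 0)))) (≡ᵇ-refl x)
pairAt-head pre x (y ∷ σ) =
  trans (cong₂ (λ b c → ((x , cnt x pre + (ind b + 0)) , (y , cnt y pre + (ind (x ≡ᵇ y) + (ind c + 0)))))
               (≡ᵇ-refl x) (≡ᵇ-refl y))
        (cong (λ z → ((x , cnt x pre + 1) , (y , z))) (x∙yz≈yx∙z (cnt y pre) (ind (x ≡ᵇ y)) 1))

pairs-annFrom : ∀ pre σ →
  map (pairAt pre σ) (interval 1 (length σ)) ≡ adjacent (annFrom pre σ) (0 , cnt 0 pre + cnt 0 σ)
pairs-annFrom pre [] = refl
pairs-annFrom pre (x ∷ σ) = cong₂ _∷_ (pairAt-head pre x σ) rest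
  where
  rest : map (pairAt pre (x ∷ σ)) (interval 2 (length σ)) ≡
         adjacent (annFrom (x ∷ pre) σ) (0 , cnt 0 pre + cnt 0 (x ∷ σ))
  rest = begin
    map (pairAt pre (x ∷ σ)) (interval 2 (length σ))
      ≡⟨ cong (map (pairAt pre (x ∷ σ))) (sym (interval-shift 1 1 (length σ))) ⟩
    map (pairAt pre (x ∷ σ)) (map suc (interval 1 (length σ)))
      ≡⟨ sym (map-∘ (interval 1 (length σ))) ⟩
    map (pairAt pre (x ∷ σ) ∘ suc) (interval 1 (length σ))
      ≡⟨ map-cong-local (interval-All 1 (length σ) (λ i 1≤i _ → pairAt-tail pre x σ i 1≤i)) ⟩
    map (pairAt (x ∷ pre) σ) (interval 1 (length σ))
      ≡⟨ pairs-annFrom (x ∷ pre) σ ⟩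
    adjacent (annFrom (x ∷ pre) σ) (0 , cnt 0 (x ∷ pre) + cnt 0 σ)
      ≡⟨ cong (λ z → adjacent (annFrom (x ∷ pre) σ) (0 , z)) (sym (x∙yz≈yx∙z (cnt 0 pre) (ind (x ≡ᵇ 0)) (cnt 0 σ))) ⟩
    adjacent (annFrom (x ∷ pre) σ) (0 , cnt 0 pre + cnt 0 (x ∷ σ)) ∎
    where open ≡-Reasoning

-- The invariant used for every statistic: in an increasing tree the letter
-- following code t (a parent copy or the sentinel) is below every label of t.
mutual
  IncAbove : {k : ℕ} → ℕ → Tree k → Set
  IncAbove lo leaf = ⊤
  IncAbove lo (node v cs) = lo < v × IncAboveV v cs

  IncAboveV : {k m : ℕ} → ℕ → Vec (Tree k) m → Set
  IncAboveV v [] = ⊤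
  IncAboveV v (c ∷ cs) = IncAbove v c × IncAboveV v cs

IncAbove-weaken : {k : ℕ} {lo lo' : ℕ} (t : Tree k) → IncAbove lo t → lo' ≤ lo → IncAbove lo' t
IncAbove-weaken leaf g _ = tt
IncAbove-weaken (node v cs) (lo<v , gs) lo'≤lo = ≤-<-trans lo'≤lo lo<v , gs

isNode : {k : ℕ} → Tree k → Bool
isNode leaf = false
isNode (node _ _) = true

first-≥-root : {k' : ℕ} (w : ℕ) (ds : Vec (Tree (suc k')) (suc (suc k'))) (s : Ann) →
  IncAboveV w ds → w ≤ proj₁ (headOr (annCode (node w ds)) s)
first-≥-root w (leaf ∷ d' ∷ ds) s _ = ≤-refl
first-≥-root w (node u es ∷ d' ∷ ds) s ((w<u , gu) , _) =
  subst (λ z → w ≤ proj₁ z) (sym (headOr-++ (annCode (node u es)) (annV w 1 (d' ∷ ds)) s))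
    (<⇒≤ (<-≤-trans w<u (first-≥-root u es (w , 1) gu)))

first-above : {k' : ℕ} {v : ℕ} (w : ℕ) (ds : Vec (Tree (suc k')) (suc (suc k'))) (s : Ann) →
  IncAbove v (node w ds) → v < proj₁ (headOr (annCode (node w ds)) s)
first-above w ds s (v<w , gw) = <-≤-trans v<w (first-≥-root w ds s gw)

-- the letter following the code of the child c in annV v i (c ∷ cs) is
-- v or the sentinel s, hence below the labels of c
next-≤ : {k m : ℕ} (v i : ℕ) (cs : Vec (Tree k) m) (s : Ann) → proj₁ s < v →
  proj₁ (headOr (annV v i cs) s) ≤ v
next-≤ v i [] s s<v = <⇒≤ s<v
next-≤ v i (_ ∷ _) s s<v = ≤-refl

above-next : {k m : ℕ} {v : ℕ} (i : ℕ) (c : Tree k) (cs : Vec (Tree k) m) (s : Ann) →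
  IncAbove v c → proj₁ s < v → IncAbove (proj₁ (headOr (annV v i cs) s)) c
above-next {v = v} i c cs s g s<v = IncAbove-weaken c g (next-≤ v i cs s s<v)

count-node : {k' : ℕ} (Q : Ann × Ann → Bool) (v : ℕ) (c : Tree (suc k')) (cs : Vec (Tree (suc k')) (suc k')) (s : Ann) →
  countB Q (adjacent (annCode (node v (c ∷ cs))) s) ≡
    countB Q (adjacent (annCode c) (headOr (annV v 1 cs) s)) + countB Q (adjacent (annV v 1 cs) s)
count-node Q v c cs s =
  trans (cong (countB Q) (adjacent-++ (annCode c) (annV v 1 cs) s))
        (countB-++ Q (adjacent (annCode c) (headOr (annV v 1 cs) s)) (adjacent (annV v 1 cs) s))

count-annV : {k m : ℕ} (Q : Ann × Ann → Bool) (v j : ℕ) (c : Tree k) (cs : Vec (Tree k) m) (s : Ann) →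
  countB Q (adjacent (annV v j (c ∷ cs)) s) ≡
    ind (Q ((v , j) , headOr (annCode c) (headOr (annV v (suc j) cs) s))) +
    (countB Q (adjacent (annCode c) (headOr (annV v (suc j) cs) s)) + countB Q (adjacent (annV v (suc j) cs) s))
count-annV Q v j c cs s =
  cong₂ (λ h r → ind (Q ((v , j) , h)) + r) (headOr-++ (annCode c) (annV v (suc j) cs) s)
    (trans (cong (countB Q) (adjacent-++ (annCode c) (annV v (suc j) cs) s))
           (countB-++ Q (adjacent (annCode c) (headOr (annV v (suc j) cs) s)) (adjacent (annV v (suc j) cs) s)))

Dᵥ : {k m : ℕ} → ℕ → Vec (Tree k) m → ℕ → ℕ
Dᵥ i cs j = countB (λ x → lastPos (proj₁ x) ≡ᵇ j) (verticesV i cs)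

Lᵥ : {k m : ℕ} → ℕ → Vec (Tree k) m → ℕ → ℕ
Lᵥ i cs j = countB (λ x → emptyAt j (proj₂ (proj₂ x))) (verticesV i cs)

LRᵥ : {k m : ℕ} → ℕ → Vec (Tree k) m → ℕ
LRᵥ {k} i cs = countB (λ x → all (λ i → (i ≡ᵇ 1) ∨ (i ≡ᵇ suc k)) (proj₁ x)) (verticesV i cs)

sizeᵥ : {k m : ℕ} → ℕ → Vec (Tree k) m → ℕ
sizeᵥ i cs = length (verticesV i cs)

size : {k : ℕ} → Tree k → ℕ
size t = length (vertices t)

-- prepending a position to the (nonempty) paths of the vertices below a
-- vertex does not change their last position
Dᵥ-below : {k m : ℕ} (i i' j : ℕ) (ds : Vec (Tree k) m) →
  countB (λ x → lastPos (i ∷ proj₁ x) ≡ᵇ j) (verticesV i' ds) ≡ Dᵥ i' ds j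
Dᵥ-below i i' j [] = refl
Dᵥ-below i i' j (d ∷ ds) =
  trans (countB-++ _ (map (prepend i') (vertices d)) (verticesV (suc i') ds))
  (trans (cong₂ _+_ (countB-map (λ x → lastPos (i ∷ proj₁ x) ≡ᵇ j) (prepend i') (vertices d)) (Dᵥ-below i (suc i') j ds))
  (sym (trans (countB-++ _ (map (prepend i') (vertices d)) (verticesV (suc i') ds))
    (cong (_+ Dᵥ (suc i') ds j) (countB-map (λ x → lastPos (proj₁ x) ≡ᵇ j) (prepend i') (vertices d))))))

Dᵥ-cons : {k m : ℕ} (i j : ℕ) (c : Tree k) (cs : Vec (Tree k) m) →
  Dᵥ i (c ∷ cs) (suc j) ≡ ind (isNode c ∧ (i ≡ᵇ suc j)) + D c (suc j) + Dᵥ (suc i) cs (suc j)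
Dᵥ-cons i j leaf cs = countB-++ _ (map (prepend i) []) (verticesV (suc i) cs)
Dᵥ-cons i j (node w ds) cs =
  trans (countB-++ _ (map (prepend i) (vertices (node w ds))) (verticesV (suc i) cs))
  (cong (_+ Dᵥ (suc i) cs (suc j))
    (trans (countB-map (λ x → lastPos (proj₁ x) ≡ᵇ suc j) (prepend i) (vertices (node w ds)))
      (cong (ind (i ≡ᵇ suc j) +_) (Dᵥ-below i 1 (suc j) ds))))

Lᵥ-cons : {k m : ℕ} (i j : ℕ) (c : Tree k) (cs : Vec (Tree k) m) →
  Lᵥ i (c ∷ cs) j ≡ L c j + Lᵥ (suc i) cs j
Lᵥ-cons i j c cs =
  trans (countB-++ _ (map (prepend i) (vertices c)) (verticesV (suc i) cs))
    (cong (_+ Lᵥ (suc i) cs j) (countB-map (λ x → emptyAt j (proj₂ (proj₂ x))) (prepend i) (vertices c)))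

sizeᵥ-cons : {k m : ℕ} (i : ℕ) (c : Tree k) (cs : Vec (Tree k) m) → sizeᵥ i (c ∷ cs) ≡ size c + sizeᵥ (suc i) cs
sizeᵥ-cons i c cs =
  trans (length-++ (map (prepend i) (vertices c)))
    (cong (_+ sizeᵥ (suc i) cs) (length-map (prepend i) (vertices c)))

LRᵥ-cons : {k m : ℕ} (i : ℕ) (c : Tree k) (cs : Vec (Tree k) m) →
  LRᵥ {k} i (c ∷ cs) ≡ (if (i ≡ᵇ 1) ∨ (i ≡ᵇ suc k) then LR c else 0) + LRᵥ (suc i) cs
LRᵥ-cons {k} i c cs =
  trans (countB-++ _ (map (prepend i) (vertices c)) (verticesV (suc i) cs))
    (cong (_+ LRᵥ (suc i) cs) (trans (countB-map _ (prepend i) (vertices c)) (outer ((i ≡ᵇ 1) ∨ (i ≡ᵇ suc k)))))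
  where
  outer : (b : Bool) → countB (λ x → b ∧ all (λ i → (i ≡ᵇ 1) ∨ (i ≡ᵇ suc k)) (proj₁ x)) (vertices c) ≡
                       (if b then LR c else 0)
  outer true = refl
  outer false = countB-none (vertices c) (tabulate (λ _ → refl))

-- an ascent/plateau is recorded with the occurrence number of its first
-- letter, a descent with that of its second letter
ascentAt descentAt plateauAt : ℕ → Ann × Ann → Bool
ascentAt j ((x , r) , (y , r')) = (x <ᵇ y) ∧ (r ≡ᵇ j)
descentAt j ((x , r) , (y , r')) = (y <ᵇ x) ∧ (r' ≡ᵇ j)
plateauAt j ((x , r) , (y , r')) = (x ≡ᵇ y) ∧ (r ≡ᵇ j)

ascent descent plateau : Ann × Ann → Bool
ascent ((x , _) , (y , _)) = x <ᵇ y
descent ((x , _) , (y , _)) = y <ᵇ x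
plateau ((x , _) , (y , _)) = x ≡ᵇ y

-- j-ascents: the copy v_j is followed by a larger letter exactly when
-- position j+1 of v holds a child

mutual
  ascents-code : {k' : ℕ} (J : ℕ) (t : Tree (suc k')) (s : Ann) → IncAbove (proj₁ s) t →
    countB (ascentAt (suc J)) (adjacent (annCode t) s) ≡ D t (suc (suc J))
  ascents-code J leaf s g = refl
  ascents-code J (node v (c ∷ c' ∷ cs)) s (s<v , gc , gV) =
    trans (count-node (ascentAt (suc J)) v c (c' ∷ cs) s)
    (trans (cong₂ _+_ (ascents-code J c (v , 1) gc) (ascents-annV J v 1 (c' ∷ cs) s gV s<v))
    (sym (trans (Dᵥ-cons 1 (suc J) c (c' ∷ cs))
                (cong (λ b → ind b + D c (suc (suc J)) + Dᵥ 2 (c' ∷ cs) (suc (suc J))) (∧-zeroʳ (isNode c))))))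

  ascents-annV : {k' m : ℕ} (J v j : ℕ) (cs : Vec (Tree (suc k')) m) (s : Ann) →
    IncAboveV v cs → proj₁ s < v →
    countB (ascentAt (suc J)) (adjacent (annV v j cs) s) ≡ Dᵥ (suc j) cs (suc (suc J))
  ascents-annV J v j [] s g s<v = refl
  ascents-annV J v j (leaf ∷ []) s g s<v rewrite <ᵇ-false {v} {proj₁ s} (<⇒≤ s<v) = refl
  ascents-annV J v j (leaf ∷ c' ∷ cs) s (_ , g) s<v =
    cong₂ (λ b r → ind (b ∧ (j ≡ᵇ suc J)) + r) (<ᵇ-irrefl v) (ascents-annV J v (suc j) (c' ∷ cs) s g s<v)
  ascents-annV J v j (node w ds ∷ cs) s (gc , g) s<v =
    trans (count-annV (ascentAt (suc J)) v j (node w ds) cs s)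
    (trans (cong₂ (λ b r → ind (b ∧ (j ≡ᵇ suc J)) + r) (<ᵇ-true (first-above w ds _ gc))
       (cong₂ _+_ (ascents-code J (node w ds) _ (above-next (suc j) (node w ds) cs s gc s<v))
                  (ascents-annV J v (suc j) cs s g s<v)))
    (trans (sym (+-assoc (ind (j ≡ᵇ suc J)) _ _)) (sym (Dᵥ-cons (suc j) (suc J) (node w ds) cs))))

-- j-descents: the last letter of the code of the child in position j is
-- followed by the smaller letter v_j; the code of t as a whole is followed
-- by the sentinel, which adds a descent of the sentinel's occurrence number

swap-regroup : ∀ a b c d → (a + b) + (c + d) ≡ (b + a + c) + d
swap-regroup a b c d = trans (sym (+-assoc (a + b) c d)) (cong (λ z → z + c + d) (+-comm a b))

mutual
  descents-code : {k' : ℕ} (J : ℕ) → J ≤ k' → (t : Tree (suc k')) (s : Ann) → IncAbove (proj₁ s) t →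
    countB (descentAt (suc J)) (adjacent (annCode t) s) ≡ D t (suc J) + ind (isNode t ∧ (proj₂ s ≡ᵇ suc J))
  descents-code J J≤k' leaf s g = refl
  descents-code J J≤k' (node v (c ∷ c' ∷ cs)) s (s<v , gc , gV) =
    trans (count-node (descentAt (suc J)) v c (c' ∷ cs) s)
    (trans (cong₂ _+_ (descents-code J J≤k' c (v , 1) gc) (descents-annV J J≤k' v 1 c' cs s gV s<v (s≤s J≤k')))
    (trans (swap-regroup (D c (suc J)) (ind (isNode c ∧ (1 ≡ᵇ suc J))) (Dᵥ 2 (c' ∷ cs) (suc J)) (ind (proj₂ s ≡ᵇ suc J)))
    (cong (_+ ind (proj₂ s ≡ᵇ suc J)) (sym (Dᵥ-cons 1 J c (c' ∷ cs))))))

  -- the children c ∷ cs occupy positions j+1 .. j+1+m of v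
  descents-annV : {k' m : ℕ} (J : ℕ) → J ≤ k' → (v j : ℕ) (c : Tree (suc k')) (cs : Vec (Tree (suc k')) m) (s : Ann) →
    IncAboveV v (c ∷ cs) → proj₁ s < v → suc J ≤ j + m →
    countB (descentAt (suc J)) (adjacent (annV v j (c ∷ cs)) s) ≡ Dᵥ (suc j) (c ∷ cs) (suc J) + ind (proj₂ s ≡ᵇ suc J)
  descents-annV J J≤k' v j leaf [] s g s<v J<j+m =
    trans (cong (λ b → ind (b ∧ (proj₂ s ≡ᵇ suc J)) + 0) (<ᵇ-true s<v)) (+-comm (ind (proj₂ s ≡ᵇ suc J)) 0)
  descents-annV J J≤k' v j leaf (c' ∷ cs) s (_ , g) s<v J<j+m =
    cong₂ (λ b r → ind (b ∧ (suc j ≡ᵇ suc J)) + r) (<ᵇ-irrefl v)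
      (descents-annV J J≤k' v (suc j) c' cs s g s<v (subst (suc J ≤_) (+-suc j _) J<j+m))
  descents-annV J J≤k' v j (node w ds) [] s (gc , g) s<v J<j+m =
    trans (count-annV (descentAt (suc J)) v j (node w ds) [] s)
    (trans (cong₂ (λ b r → ind (b ∧ (proj₂ (headOr (annCode (node w ds)) s) ≡ᵇ suc J)) + (r + 0))
                  (<ᵇ-false (<⇒≤ (first-above w ds s gc)))
                  (descents-code J J≤k' (node w ds) s (IncAbove-weaken (node w ds) gc (<⇒≤ s<v))))
    (trans (+-identityʳ (D (node w ds) (suc J) + ind (proj₂ s ≡ᵇ suc J)))
    (trans (cong (_+ ind (proj₂ s ≡ᵇ suc J)) (sym (+-identityʳ (D (node w ds) (suc J)))))
    (sym (trans (cong (_+ ind (proj₂ s ≡ᵇ suc J)) (Dᵥ-cons (suc j) J (node w ds) []))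
         (cong (λ b → ind b + D (node w ds) (suc J) + 0 + ind (proj₂ s ≡ᵇ suc J))
               (≡ᵇ-false-> {j} {J} (subst (suc J ≤_) (+-identityʳ j) J<j+m))))))))
  descents-annV J J≤k' v j (node w ds) (c' ∷ cs) s (gc , g) s<v J<j+m =
    trans (count-annV (descentAt (suc J)) v j (node w ds) (c' ∷ cs) s)
    (trans (cong₂ (λ b r → ind (b ∧ (proj₂ (headOr (annCode (node w ds)) (v , suc j)) ≡ᵇ suc J)) + r)
                  (<ᵇ-false (<⇒≤ (first-above w ds (v , suc j) gc)))
      (cong₂ _+_ (descents-code J J≤k' (node w ds) (v , suc j) gc)
                 (descents-annV J J≤k' v (suc j) c' cs s g s<v (subst (suc J ≤_) (+-suc j _) J<j+m))))
    (trans (swap-regroup (D (node w ds) (suc J)) (ind (suc j ≡ᵇ suc J)) (Dᵥ (suc (suc j)) (c' ∷ cs) (suc J)) (ind (proj₂ s ≡ᵇ suc J)))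
    (cong (_+ ind (proj₂ s ≡ᵇ suc J)) (sym (Dᵥ-cons (suc j) J (node w ds) (c' ∷ cs))))))

-- j-plateaux: v_j v_{j+1} is a plateau exactly when position j+1 of v is
-- empty and is not the last position

plateausᵥ : {k m : ℕ} → ℕ → ℕ → Vec (Tree k) m → ℕ
plateausᵥ j J [] = 0
plateausᵥ j J (leaf ∷ []) = 0
plateausᵥ j J (leaf ∷ c' ∷ cs) = ind (j ≡ᵇ J) + plateausᵥ (suc j) J (c' ∷ cs)
plateausᵥ j J (node w ds ∷ cs) = plateausᵥ (suc j) J cs

plateausᵥ-below : {k m : ℕ} (j J : ℕ) (cs : Vec (Tree k) m) → J < j → plateausᵥ j J cs ≡ 0
plateausᵥ-below j J [] J<j = refl
plateausᵥ-below j J (leaf ∷ []) J<j = refl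
plateausᵥ-below j J (leaf ∷ c' ∷ cs) J<j =
  cong₂ (λ b r → ind b + r) (≡ᵇ-false-> J<j) (plateausᵥ-below (suc j) J (c' ∷ cs) (m≤n⇒m≤1+n J<j))
plateausᵥ-below j J (node w ds ∷ cs) J<j = plateausᵥ-below (suc j) J cs (m≤n⇒m≤1+n J<j)

plateausᵥ-at : {k m : ℕ} (j r : ℕ) (cs : Vec (Tree k) m) → suc (suc r) ≤ m →
  plateausᵥ j (j + r) cs ≡ ind (emptyAt (suc r) cs)
plateausᵥ-at j r (leaf ∷ []) (s≤s ())
plateausᵥ-at j zero (leaf ∷ c' ∷ cs) _ =
  cong₂ (λ b r → ind b + r) (trans (cong (j ≡ᵇ_) (+-identityʳ j)) (≡ᵇ-refl j))
    (plateausᵥ-below (suc j) (j + 0) (c' ∷ cs) (s≤s (≤-reflexive (+-identityʳ j))))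
plateausᵥ-at j (suc r) (leaf ∷ c' ∷ cs) (s≤s r<m) =
  cong₂ (λ b r → ind b + r) (≡ᵇ-false-< {j} {j + suc r} (subst (j <_) (sym (+-suc j r)) (s≤s (m≤m+n j r))))
    (trans (cong (λ z → plateausᵥ (suc j) z (c' ∷ cs)) (+-suc j r)) (plateausᵥ-at (suc j) r (c' ∷ cs) r<m))
plateausᵥ-at j zero (node w ds ∷ cs) _ =
  plateausᵥ-below (suc j) (j + 0) cs (s≤s (≤-reflexive (+-identityʳ j)))
plateausᵥ-at j (suc r) (node w ds ∷ cs) (s≤s r<m) =
  trans (cong (λ z → plateausᵥ (suc j) z cs) (+-suc j r)) (plateausᵥ-at (suc j) r cs r<m)

mutual
  plateaus-code : {k' : ℕ} (J : ℕ) → suc J ≤ k' → (t : Tree (suc k')) (s : Ann) → IncAbove (proj₁ s) t →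
    countB (plateauAt (suc J)) (adjacent (annCode t) s) ≡ L t (suc (suc J))
  plateaus-code J J<k' leaf s g = refl
  plateaus-code J J<k' (node v (c ∷ c' ∷ cs)) s (s<v , gc , gV) =
    trans (count-node (plateauAt (suc J)) v c (c' ∷ cs) s)
    (trans (cong₂ _+_ (plateaus-code J J<k' c (v , 1) gc) (plateaus-annV J J<k' v 1 (c' ∷ cs) s gV s<v))
    (trans (cong (λ z → L c (suc (suc J)) + (z + Lᵥ 2 (c' ∷ cs) (suc (suc J)))) (plateausᵥ-at 1 J (c' ∷ cs) (s≤s J<k')))
    (trans (x∙yz≈y∙xz (L c (suc (suc J))) (ind (emptyAt (suc J) (c' ∷ cs))) (Lᵥ 2 (c' ∷ cs) (suc (suc J))))
    (cong (ind (emptyAt (suc J) (c' ∷ cs)) +_) (sym (Lᵥ-cons 1 (suc (suc J)) c (c' ∷ cs)))))))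

  plateaus-annV : {k' m : ℕ} (J : ℕ) → suc J ≤ k' → (v j : ℕ) (cs : Vec (Tree (suc k')) m) (s : Ann) →
    IncAboveV v cs → proj₁ s < v →
    countB (plateauAt (suc J)) (adjacent (annV v j cs) s) ≡ plateausᵥ j (suc J) cs + Lᵥ (suc j) cs (suc (suc J))
  plateaus-annV J J<k' v j [] s g s<v = refl
  plateaus-annV J J<k' v j (leaf ∷ []) s g s<v = cong (λ b → ind (b ∧ (j ≡ᵇ suc J)) + 0) (≡ᵇ-false-> s<v)
  plateaus-annV J J<k' v j (leaf ∷ c' ∷ cs) s (_ , g) s<v =
    trans (cong₂ (λ b r → ind (b ∧ (j ≡ᵇ suc J)) + r) (≡ᵇ-refl v) (plateaus-annV J J<k' v (suc j) (c' ∷ cs) s g s<v))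
      (sym (+-assoc (ind (j ≡ᵇ suc J)) (plateausᵥ (suc j) (suc J) (c' ∷ cs)) (Lᵥ (suc (suc j)) (c' ∷ cs) (suc (suc J)))))
  plateaus-annV J J<k' v j (node w ds ∷ cs) s (gc , g) s<v =
    trans (count-annV (plateauAt (suc J)) v j (node w ds) cs s)
    (trans (cong₂ (λ b r → ind (b ∧ (j ≡ᵇ suc J)) + r) (≡ᵇ-false-< (first-above w ds _ gc))
      (cong₂ _+_ (plateaus-code J J<k' (node w ds) _ (above-next (suc j) (node w ds) cs s gc s<v))
                 (plateaus-annV J J<k' v (suc j) cs s g s<v)))
    (trans (x∙yz≈y∙xz (L (node w ds) (suc (suc J))) (plateausᵥ (suc j) (suc J) cs) (Lᵥ (suc (suc j)) cs (suc (suc J))))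
    (cong (plateausᵥ (suc j) (suc J) cs +_) (sym (Lᵥ-cons (suc j) (suc (suc J)) (node w ds) cs)))))

-- Total ascents: the ascents whose first letter lies in code t correspond
-- to the non-root vertices of t that do not occupy position 1

mutual
  ascents-total : {k' : ℕ} (t : Tree (suc k')) (s : Ann) → IncAbove (proj₁ s) t →
    countB ascent (adjacent (annCode t) s) + D t 1 + ind (isNode t) ≡ size t
  ascents-total leaf s g = refl
  ascents-total (node v (c ∷ c' ∷ cs)) s (s<v , gc , gV) =
    trans (cong (λ z → z + D (node v (c ∷ c' ∷ cs)) 1 + 1) (count-node ascent v c (c' ∷ cs) s))
    (trans (cong (λ z → ac + av + z + 1)
                 (trans (Dᵥ-cons 1 0 c (c' ∷ cs)) (cong (λ b → ind b + D c 1 + Dᵥ 2 (c' ∷ cs) 1) (∧-identityʳ (isNode c)))))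
    (trans (regroup ac av (ind (isNode c)) (D c 1) (Dᵥ 2 (c' ∷ cs) 1))
    (cong suc (trans (cong₂ _+_ (ascents-total c (v , 1) gc) (ascents-totalᵥ v 0 (c' ∷ cs) s gV s<v))
      (sym (sizeᵥ-cons 1 c (c' ∷ cs)))))))
    where
    ac = countB ascent (adjacent (annCode c) (v , 1))
    av = countB ascent (adjacent (annV v 1 (c' ∷ cs)) s)
    regroup : ∀ a b c d e → (a + b) + (c + d + e) + 1 ≡ suc ((a + d + c) + (b + e))
    regroup = solve-∀

  ascents-totalᵥ : {k' m : ℕ} (v j : ℕ) (cs : Vec (Tree (suc k')) m) (s : Ann) → IncAboveV v cs → proj₁ s < v →
    countB ascent (adjacent (annV v (suc j) cs) s) + Dᵥ (suc (suc j)) cs 1 ≡ sizeᵥ (suc (suc j)) cs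
  ascents-totalᵥ v j [] s g s<v = refl
  ascents-totalᵥ v j (leaf ∷ cs) s (_ , g) s<v =
    trans (cong (λ b → ind b + countB ascent (adjacent (annV v (suc (suc j)) cs) s) + Dᵥ (suc (suc (suc j))) cs 1)
                (<ᵇ-false (next-≤ v (suc (suc j)) cs s s<v)))
      (ascents-totalᵥ v (suc j) cs s g s<v)
  ascents-totalᵥ v j (node w ds ∷ cs) s (gc , g) s<v =
    trans (cong₂ _+_ (trans (count-annV ascent v (suc j) (node w ds) cs s)
                            (cong (λ b → ind b + (aw + ar)) (<ᵇ-true (first-above w ds _ gc))))
                     (Dᵥ-cons (suc (suc j)) 0 (node w ds) cs))
    (trans (regroup aw ar (D (node w ds) 1) (Dᵥ (suc (suc (suc j))) cs 1))
    (trans (cong₂ _+_ (ascents-total (node w ds) _ (above-next (suc (suc j)) (node w ds) cs s gc s<v))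
                      (ascents-totalᵥ v (suc j) cs s g s<v))
    (sym (sizeᵥ-cons (suc (suc j)) (node w ds) cs))))
    where
    aw = countB ascent (adjacent (annCode (node w ds)) (headOr (annV v (suc (suc j)) cs) s))
    ar = countB ascent (adjacent (annV v (suc (suc j)) cs) s)
    regroup : ∀ a b c d → (1 + (a + b)) + (0 + c + d) ≡ (a + c + 1) + (b + d)
    regroup = solve-∀

-- Total descents: the descents whose first letter lies in code t
-- correspond to the vertices of t not occupying position k+1 (the last
-- letter of code u is followed by a smaller letter)

mutual
  descents-total : {k' : ℕ} (t : Tree (suc k')) (s : Ann) → IncAbove (proj₁ s) t →
    countB descent (adjacent (annCode t) s) + D t (suc (suc k')) ≡ size t
  descents-total leaf s g = refl
  descents-total {k'} (node v (c ∷ c' ∷ cs)) s (s<v , gc , gV) =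
    trans (cong₂ _+_ (count-node descent v c (c' ∷ cs) s)
            (trans (Dᵥ-cons 1 (suc k') c (c' ∷ cs))
                   (cong (λ b → ind b + D c (suc (suc k')) + Dᵥ 2 (c' ∷ cs) (suc (suc k'))) (∧-zeroʳ (isNode c)))))
    (trans (interchange dc dv (D c (suc (suc k'))) (Dᵥ 2 (c' ∷ cs) (suc (suc k'))))
    (trans (cong₂ _+_ (descents-total c (v , 1) gc) (descents-totalᵥ v 1 c' cs s gV s<v refl))
    (trans (sym (+-assoc (size c) (sizeᵥ 2 (c' ∷ cs)) 1))
    (trans (+-comm (size c + sizeᵥ 2 (c' ∷ cs)) 1) (cong suc (sym (sizeᵥ-cons 1 c (c' ∷ cs))))))))
    where
    dc = countB descent (adjacent (annCode c) (v , 1))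
    dv = countB descent (adjacent (annV v 1 (c' ∷ cs)) s)

  -- here the children c ∷ cs occupy the positions j+1 .. k+1
  descents-totalᵥ : {k' m : ℕ} (v j : ℕ) (c : Tree (suc k')) (cs : Vec (Tree (suc k')) m) (s : Ann) →
    IncAboveV v (c ∷ cs) → proj₁ s < v → j + m ≡ suc k' →
    countB descent (adjacent (annV v j (c ∷ cs)) s) + Dᵥ (suc j) (c ∷ cs) (suc (suc k')) ≡ sizeᵥ (suc j) (c ∷ cs) + 1
  descents-totalᵥ v j leaf [] s g s<v e = cong (λ b → ind b + 0 + 0) (<ᵇ-true s<v)
  descents-totalᵥ {k'} v j leaf (c' ∷ cs) s (_ , g) s<v e =
    trans (cong (λ b → ind b + countB descent (adjacent (annV v (suc j) (c' ∷ cs)) s) + Dᵥ (suc (suc j)) (c' ∷ cs) (suc (suc k')))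
                (<ᵇ-irrefl v))
      (descents-totalᵥ v (suc j) c' cs s g s<v (trans (sym (+-suc j _)) e))
  descents-totalᵥ {k'} v j (node w ds) [] s (gc , g) s<v e =
    trans (cong₂ _+_ (trans (count-annV descent v j (node w ds) [] s)
                            (cong (λ b → ind b + (dw + 0)) (<ᵇ-false (<⇒≤ (first-above w ds s gc)))))
            (trans (Dᵥ-cons (suc j) (suc k') (node w ds) [])
                   (cong (λ b → ind b + D (node w ds) (suc (suc k')) + 0)
                         (trans (cong (j ≡ᵇ_) (sym (trans (sym (+-identityʳ j)) e))) (≡ᵇ-refl j)))))
    (trans (regroup dw (D (node w ds) (suc (suc k'))))
    (cong (_+ 1) (trans (descents-total (node w ds) s (IncAbove-weaken (node w ds) gc (<⇒≤ s<v)))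
                        (trans (sym (+-identityʳ _)) (sym (sizeᵥ-cons (suc j) (node w ds) []))))))
    where
    dw = countB descent (adjacent (annCode (node w ds)) s)
    regroup : ∀ a b → (0 + (a + 0)) + (1 + b + 0) ≡ (a + b) + 1
    regroup = solve-∀
  descents-totalᵥ {k'} v j (node w ds) (c' ∷ cs) s (gc , g) s<v e =
    trans (cong₂ _+_ (trans (count-annV descent v j (node w ds) (c' ∷ cs) s)
                            (cong (λ b → ind b + (dw + dr)) (<ᵇ-false (<⇒≤ (first-above w ds (v , suc j) gc)))))
            (trans (Dᵥ-cons (suc j) (suc k') (node w ds) (c' ∷ cs))
                   (cong (λ b → ind b + D (node w ds) (suc (suc k')) + Dᵥ (suc (suc j)) (c' ∷ cs) (suc (suc k')))
                         (≡ᵇ-false-< {j} {suc k'} (subst (j <_) e (subst (j <_) (sym (+-suc j _)) (s≤s (m≤m+n j _))))))))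
    (trans (interchange dw dr (D (node w ds) (suc (suc k'))) (Dᵥ (suc (suc j)) (c' ∷ cs) (suc (suc k'))))
    (trans (cong₂ _+_ (descents-total (node w ds) (v , suc j) gc) (descents-totalᵥ v (suc j) c' cs s g s<v (trans (sym (+-suc j _)) e)))
    (trans (sym (+-assoc (size (node w ds)) (sizeᵥ (suc (suc j)) (c' ∷ cs)) 1))
           (cong (_+ 1) (sym (sizeᵥ-cons (suc j) (node w ds) (c' ∷ cs)))))))
    where
    dw = countB descent (adjacent (annCode (node w ds)) (v , suc j))
    dr = countB descent (adjacent (annV v (suc j) (c' ∷ cs)) s)

-- L_{j} + D_{j} = n: position j of a vertex is either empty or occupied

occupiedᵥ : {k m : ℕ} → ℕ → Vec (Tree k) m → ℕ → ℕ
occupiedᵥ i [] j = 0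
occupiedᵥ i (c ∷ cs) j = ind (isNode c ∧ (i ≡ᵇ j)) + occupiedᵥ (suc i) cs j

occupiedᵥ-below : {k m : ℕ} (i j : ℕ) (cs : Vec (Tree k) m) → j < i → occupiedᵥ i cs j ≡ 0
occupiedᵥ-below i j [] j<i = refl
occupiedᵥ-below i j (c ∷ cs) j<i =
  trans (cong₂ (λ b r → ind (isNode c ∧ b) + r) (≡ᵇ-false-> j<i) (occupiedᵥ-below (suc i) j cs (m≤n⇒m≤1+n j<i)))
        (cong (λ b → ind b + 0) (∧-zeroʳ (isNode c)))

empty-or-occupied : {k m : ℕ} (i r : ℕ) (cs : Vec (Tree k) m) → r < m →
  ind (emptyAt (suc r) cs) + occupiedᵥ i cs (i + r) ≡ 1
empty-or-occupied i zero (leaf ∷ cs) _ =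
  cong suc (occupiedᵥ-below (suc i) (i + 0) cs (s≤s (≤-reflexive (+-identityʳ i))))
empty-or-occupied i zero (node w ds ∷ cs) _ =
  cong₂ (λ b r → ind b + r) (trans (cong (i ≡ᵇ_) (+-identityʳ i)) (≡ᵇ-refl i))
    (occupiedᵥ-below (suc i) (i + 0) cs (s≤s (≤-reflexive (+-identityʳ i))))
empty-or-occupied i (suc r) (c ∷ cs) (s≤s r<m) =
  trans (cong₂ (λ b z → ind (emptyAt (suc r) cs) + (ind (isNode c ∧ b) + z))
          (≡ᵇ-false-< {i} {i + suc r} (subst (i <_) (sym (+-suc i r)) (s≤s (m≤m+n i r))))
          (cong (occupiedᵥ (suc i) cs) (+-suc i r)))
  (trans (cong (λ b → ind (emptyAt (suc r) cs) + (ind b + occupiedᵥ (suc i) cs (suc i + r))) (∧-zeroʳ (isNode c)))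
         (empty-or-occupied (suc i) r cs r<m))

mutual
  empty+occupied : {k : ℕ} (j : ℕ) → j ≤ k → (t : Tree k) → L t (suc j) + D t (suc j) ≡ size t
  empty+occupied j j≤k leaf = refl
  empty+occupied j j≤k (node v cs) = begin
    (e + Lᵥ 1 cs (suc j)) + Dᵥ 1 cs (suc j)       ≡⟨ +-assoc e _ _ ⟩
    e + (Lᵥ 1 cs (suc j) + Dᵥ 1 cs (suc j))       ≡⟨ cong (e +_) (empty+occupiedᵥ j j≤k 1 cs) ⟩
    e + (sizeᵥ 1 cs + occupiedᵥ 1 cs (suc j))     ≡⟨ x∙yz≈y∙xz e (sizeᵥ 1 cs) _ ⟩
    sizeᵥ 1 cs + (e + occupiedᵥ 1 cs (suc j))     ≡⟨ cong (sizeᵥ 1 cs +_) (empty-or-occupied 1 j cs (s≤s j≤k)) ⟩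
    sizeᵥ 1 cs + 1                                ≡⟨ +-comm (sizeᵥ 1 cs) 1 ⟩
    suc (sizeᵥ 1 cs)                              ∎
    where
    open ≡-Reasoning
    e = ind (emptyAt (suc j) cs)

  empty+occupiedᵥ : {k m : ℕ} (j : ℕ) → j ≤ k → (i : ℕ) (cs : Vec (Tree k) m) →
    Lᵥ i cs (suc j) + Dᵥ i cs (suc j) ≡ sizeᵥ i cs + occupiedᵥ i cs (suc j)
  empty+occupiedᵥ j j≤k i [] = refl
  empty+occupiedᵥ j j≤k i (c ∷ cs) = begin
    Lᵥ i (c ∷ cs) (suc j) + Dᵥ i (c ∷ cs) (suc j)
      ≡⟨ cong₂ _+_ (Lᵥ-cons i (suc j) c cs) (Dᵥ-cons i j c cs) ⟩
    (L c (suc j) + Lᵥ (suc i) cs (suc j)) + (o + D c (suc j) + Dᵥ (suc i) cs (suc j))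
      ≡⟨ regroup (L c (suc j)) (Lᵥ (suc i) cs (suc j)) o (D c (suc j)) (Dᵥ (suc i) cs (suc j)) ⟩
    (L c (suc j) + D c (suc j)) + (Lᵥ (suc i) cs (suc j) + Dᵥ (suc i) cs (suc j)) + o
      ≡⟨ cong₂ (λ a b → a + b + o) (empty+occupied j j≤k c) (empty+occupiedᵥ j j≤k (suc i) cs) ⟩
    size c + (sizeᵥ (suc i) cs + occupiedᵥ (suc i) cs (suc j)) + o
      ≡⟨ regroup′ (size c) (sizeᵥ (suc i) cs) (occupiedᵥ (suc i) cs (suc j)) o ⟩
    (size c + sizeᵥ (suc i) cs) + (o + occupiedᵥ (suc i) cs (suc j))
      ≡⟨ cong (_+ occupiedᵥ i (c ∷ cs) (suc j)) (sym (sizeᵥ-cons i c cs)) ⟩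
    sizeᵥ i (c ∷ cs) + occupiedᵥ i (c ∷ cs) (suc j) ∎
    where
    open ≡-Reasoning
    o = ind (isNode c ∧ (i ≡ᵇ suc j))
    regroup : ∀ a b c d e → (a + b) + (c + d + e) ≡ (a + d) + (b + e) + c
    regroup = solve-∀
    regroup′ : ∀ a b c d → a + (b + c) + d ≡ (a + b) + (d + c)
    regroup′ = solve-∀

-- Total plateaux: v_j v_{j+1} is a plateau iff position j+1 of v is empty
-- (2 ≤ j+1 ≤ k), so the plateaux count Σ_{j=2}^{k} L_j

plateausᵥ-total : {k m : ℕ} → Vec (Tree k) m → ℕ
plateausᵥ-total [] = 0
plateausᵥ-total (leaf ∷ []) = 0
plateausᵥ-total (leaf ∷ c' ∷ cs) = 1 + plateausᵥ-total (c' ∷ cs)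
plateausᵥ-total (node w ds ∷ cs) = plateausᵥ-total cs

mutual
  empties-tail : {k : ℕ} (m : ℕ) (c : Tree k) (cs : Vec (Tree k) (suc m)) →
    sum (map (λ J → ind (emptyAt J (c ∷ cs))) (interval 2 m)) ≡ plateausᵥ-total cs
  empties-tail m c cs =
    trans (cong (λ z → sum (map (λ J → ind (emptyAt J (c ∷ cs))) z)) (sym (interval-shift 1 1 m)))
    (trans (cong sum (sym (map-∘ (interval 1 m))))
    (trans (cong sum (map-cong-local (interval-All 1 m (λ { (suc x) _ _ → refl }))))
    (empties-non-last m cs)))

  empties-non-last : {k : ℕ} (m : ℕ) (cs : Vec (Tree k) (suc m)) →
    sum (map (λ J → ind (emptyAt J cs)) (interval 1 m)) ≡ plateausᵥ-total cs
  empties-non-last zero (leaf ∷ []) = refl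
  empties-non-last zero (node w ds ∷ []) = refl
  empties-non-last (suc m) (leaf ∷ c' ∷ cs) = cong suc (empties-tail m leaf (c' ∷ cs))
  empties-non-last (suc m) (node w ds ∷ c' ∷ cs) = empties-tail m (node w ds) (c' ∷ cs)

mutual
  plateaus-total : {k' : ℕ} (t : Tree (suc k')) (s : Ann) → IncAbove (proj₁ s) t →
    countB plateau (adjacent (annCode t) s) ≡ sum (map (L t) (interval 2 k'))
  plateaus-total {k'} leaf s g = sym (sum-map-0 (interval 2 k'))
  plateaus-total {k'} (node v (c ∷ c' ∷ cs)) s (s<v , gc , gV) = begin
    countB plateau (adjacent (annCode (node v (c ∷ c' ∷ cs))) s)
      ≡⟨ count-node plateau v c (c' ∷ cs) s ⟩
    _ ≡⟨ cong₂ _+_ (plateaus-total c (v , 1) gc) (plateaus-totalᵥ v 1 (c' ∷ cs) s gV s<v) ⟩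
    Σ (L c) + (plateausᵥ-total (c' ∷ cs) + Σ (Lᵥ 2 (c' ∷ cs)))
      ≡⟨ cong (λ z → Σ (L c) + (z + Σ (Lᵥ 2 (c' ∷ cs)))) (sym (empties-tail k' c (c' ∷ cs))) ⟩
    Σ (L c) + (Σ E + Σ (Lᵥ 2 (c' ∷ cs)))
      ≡⟨ x∙yz≈y∙xz (Σ (L c)) (Σ E) _ ⟩
    Σ E + (Σ (L c) + Σ (Lᵥ 2 (c' ∷ cs)))
      ≡⟨ cong (Σ E +_) (sym (sum-map-+ (L c) (Lᵥ 2 (c' ∷ cs)) (interval 2 k'))) ⟩
    Σ E + Σ (λ J → L c J + Lᵥ 2 (c' ∷ cs) J)
      ≡⟨ sym (sum-map-+ E (λ J → L c J + Lᵥ 2 (c' ∷ cs) J) (interval 2 k')) ⟩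
    Σ (λ J → E J + (L c J + Lᵥ 2 (c' ∷ cs) J))
      ≡⟨ cong sum (map-cong (λ J → cong (E J +_) (sym (Lᵥ-cons 1 J c (c' ∷ cs)))) (interval 2 k')) ⟩
    Σ (L (node v (c ∷ c' ∷ cs))) ∎
    where
    open ≡-Reasoning
    Σ : (ℕ → ℕ) → ℕ
    Σ f = sum (map f (interval 2 k'))
    E : ℕ → ℕ
    E J = ind (emptyAt J (c ∷ c' ∷ cs))

  plateaus-totalᵥ : {k' m : ℕ} (v j : ℕ) (cs : Vec (Tree (suc k')) m) (s : Ann) → IncAboveV v cs → proj₁ s < v →
    countB plateau (adjacent (annV v j cs) s) ≡ plateausᵥ-total cs + sum (map (Lᵥ (suc j) cs) (interval 2 k'))
  plateaus-totalᵥ {k'} v j [] s g s<v = sym (sum-map-0 (interval 2 k'))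
  plateaus-totalᵥ {k'} v j (leaf ∷ []) s g s<v =
    trans (cong (λ b → ind b + 0) (≡ᵇ-false-> s<v)) (sym (sum-map-0 (interval 2 k')))
  plateaus-totalᵥ {k'} v j (leaf ∷ c' ∷ cs) s (_ , g) s<v =
    cong₂ (λ b r → ind b + r) (≡ᵇ-refl v) (plateaus-totalᵥ v (suc j) (c' ∷ cs) s g s<v)
  plateaus-totalᵥ {k'} v j (node w ds ∷ cs) s (gc , g) s<v =
    trans (count-annV plateau v j (node w ds) cs s)
    (trans (cong₂ (λ b r → ind b + r) (≡ᵇ-false-< (first-above w ds _ gc))
      (cong₂ _+_ (plateaus-total (node w ds) _ (above-next (suc j) (node w ds) cs s gc s<v))
                 (plateaus-totalᵥ v (suc j) cs s g s<v)))
    (trans (x∙yz≈y∙xz (sum (map (L (node w ds)) (interval 2 k'))) (plateausᵥ-total cs) _)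
    (cong (plateausᵥ-total cs +_) (sym (trans (cong sum (map-cong (λ J → Lᵥ-cons (suc j) J (node w ds) cs) (interval 2 k')))
       (sum-map-+ (L (node w ds)) (Lᵥ (suc (suc j)) cs) (interval 2 k')))))))

blockAt : List ℕ → ℕ → ℕ → ℕ → Bool
blockAt σ m p q =
  isClosed σ p q ∧
  not (any (λ p' → any (λ q' → isClosed σ p' q' ∧ ((p' <ᵇ p) ∨ (q <ᵇ q'))) (range q m)) (range 1 p))

blocksFrom : List ℕ → ℕ → ℕ → ℕ
blocksFrom σ m p = countB (blockAt σ m p) (range p m)

blocks : List ℕ → ℕ → ℕ
blocks σ m = sum (map (blocksFrom σ m) (range 1 m))

a<a+q : ∀ a q → 1 ≤ q → a < a + q
a<a+q a q 1≤q = subst (_≤ a + q) (+-comm a 1) (+-monoʳ-≤ a 1≤q)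

-- If the word a₁ ⋯ a_{a+b} consists of u (length a) followed by w (length b)
-- and no letter of u equals a letter of w, then no block meets both parts,
-- and the blocks are those of u together with (shifted) those of w.
module Split (σ u w : List ℕ) (a b : ℕ)
  (σ≈u : ∀ i → i ≤ a → at σ i ≡ at u i)
  (σ≈w : ∀ i → at σ (a + suc i) ≡ at w (suc i))
  (apart : ∀ p q → 1 ≤ p → p ≤ a → a < q → q ≤ a + b → isClosed σ p q ≡ false) where

  closed-u : ∀ p q → p ≤ a → q ≤ a → isClosed σ p q ≡ isClosed u p q
  closed-u p q p≤a q≤a = cong₂ _≡ᵇ_ (σ≈u p p≤a) (σ≈u q q≤a)

  closed-w : ∀ p q → 1 ≤ p → 1 ≤ q → isClosed σ (a + p) (a + q) ≡ isClosed w p q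
  closed-w (suc p) (suc q) _ _ = cong₂ _≡ᵇ_ (σ≈w p) (σ≈w q)

  blocksFrom-u : ∀ p → 1 ≤ p → p ≤ a → blocksFrom σ (a + b) p ≡ blocksFrom u a p
  blocksFrom-u p 1≤p p≤a =
    trans (cong (countB (blockAt σ (a + b) p)) (range-split p a b (m≤n⇒m≤1+n p≤a)))
    (trans (countB-++ (blockAt σ (a + b) p) (range p a) (interval (suc a) b))
    (trans (cong₂ _+_ (countB-cong-local (range p a) (range-All p a (λ q p≤q q≤a → same q p≤q q≤a)))
                      (countB-none (interval (suc a) b)
                        (interval-All (suc a) b (λ q a<q q<1+a+b → ∧-false-l (apart p q 1≤p p≤a a<q (≤-pred q<1+a+b))))))
    (+-identityʳ _)))
    where
    same : ∀ q → p ≤ q → q ≤ a → blockAt σ (a + b) p q ≡ blockAt u a p q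
    same q p≤q q≤a = cong₂ (λ x y → x ∧ not y) (closed-u p q p≤a q≤a)
      (any-cong-local (range 1 p) (range-All 1 p (λ p' 1≤p' p'≤p →
        trans (cong (any _) (range-split q a b (m≤n⇒m≤1+n q≤a)))
        (trans (any-++ _ (range q a) (interval (suc a) b))
        (trans (cong₂ _∨_
                 (any-cong-local (range q a) (range-All q a (λ q' _ q'≤a →
                    cong (_∧ ((p' <ᵇ p) ∨ (q <ᵇ q'))) (closed-u p' q' (≤-trans p'≤p p≤a) q'≤a))))
                 (any-none (interval (suc a) b) (interval-All (suc a) b (λ q' a<q' q'<1+a+b →
                    ∧-false-l (apart p' q' 1≤p' (≤-trans p'≤p p≤a) a<q' (≤-pred q'<1+a+b))))))
        (∨-identityʳ _))))))

  blocksFrom-w : ∀ p → 1 ≤ p → p ≤ b → blocksFrom σ (a + b) (a + p) ≡ blocksFrom w b p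
  blocksFrom-w p 1≤p p≤b =
    trans (cong (countB (blockAt σ (a + b) (a + p))) (range-shift a p b))
    (trans (countB-map (blockAt σ (a + b) (a + p)) (a +_) (range p b))
    (countB-cong-local (range p b) (range-All p b (λ q p≤q q≤b → same q p≤q q≤b))))
    where
    same : ∀ q → p ≤ q → q ≤ b → blockAt σ (a + b) (a + p) (a + q) ≡ blockAt w b p q
    same q p≤q q≤b = cong₂ (λ x y → x ∧ not y) (closed-w p q 1≤p (≤-trans 1≤p p≤q))
      (trans (cong (any outer) (trans (range-one (a + p)) (trans (interval-+ 1 a p) (cong (interval 1 a ++_) (sym (interval-shift a 1 p))))))
      (trans (any-++ outer (interval 1 a) (map (a +_) (interval 1 p)))
      (cong₂ _∨_ in-u in-w)))
      where
      outer : ℕ → Bool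
      outer p' = any (λ q' → isClosed σ p' q' ∧ ((p' <ᵇ a + p) ∨ (a + q <ᵇ q'))) (range (a + q) (a + b))
      in-u : any outer (interval 1 a) ≡ false
      in-u = any-none (interval 1 a) (interval-All 1 a (λ p' 1≤p' p'<1+a →
          trans (cong (any _) (range-shift a q b))
          (trans (any-map _ (a +_) (range q b))
          (any-none (range q b) (range-All q b (λ q'' q≤q'' q''≤b →
             ∧-false-l (apart p' (a + q'') 1≤p' (≤-pred p'<1+a)
               (a<a+q a q'' (≤-trans 1≤p (≤-trans p≤q q≤q'')))
               (+-monoʳ-≤ a q''≤b))))))))
      in-w : any outer (map (a +_) (interval 1 p)) ≡
             any (λ p' → any (λ q' → isClosed w p' q' ∧ ((p' <ᵇ p) ∨ (q <ᵇ q'))) (range q b)) (range 1 p)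
      in-w = trans (any-map outer (a +_) (interval 1 p))
        (trans (any-cong-local (interval 1 p) (interval-All 1 p (λ p'' 1≤p'' _ →
          trans (cong (any _) (range-shift a q b))
          (trans (any-map _ (a +_) (range q b))
          (any-cong-local (range q b) (range-All q b (λ q'' q≤q'' _ →
             cong₂ _∧_ (closed-w p'' q'' 1≤p'' (≤-trans 1≤p (≤-trans p≤q q≤q'')))
               (cong₂ _∨_ (+-<ᵇ a p'' p) (+-<ᵇ a q q'')))))))))
        (sym (cong (any _) (range-one p))))

  blocks-split : blocks σ (a + b) ≡ blocks u a + blocks w b
  blocks-split =
    trans (cong (λ z → sum (map (blocksFrom σ (a + b)) z))
                (trans (range-one (a + b)) (trans (interval-+ 1 a b) (cong (interval 1 a ++_) (sym (interval-shift a 1 b))))))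
    (trans (sum-map-++ (blocksFrom σ (a + b)) (interval 1 a) (map (a +_) (interval 1 b)))
    (cong₂ _+_
      (trans (cong sum (map-cong-local (interval-All 1 a (λ p 1≤p p<1+a → blocksFrom-u p 1≤p (≤-pred p<1+a)))))
             (cong (λ z → sum (map (blocksFrom u a) z)) (sym (range-one a))))
      (trans (cong sum (sym (map-∘ (interval 1 b))))
      (trans (cong sum (map-cong-local (interval-All 1 b (λ p 1≤p p<1+b → blocksFrom-w p 1≤p (≤-pred p<1+b)))))
             (cong (λ z → sum (map (blocksFrom w b) z)) (sym (range-one b)))))))

-- A word a₁ ⋯ a_{m+1} with a_{m+1} = a₁ has exactly one block, (1 , m+1):
-- every other closed pair lies inside it.
module SingleBlock (M : List ℕ) (m : ℕ) (ends : at M (suc m) ≡ at M 1) where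

  whole-closed : isClosed M 1 (suc m) ≡ true
  whole-closed = trans (cong (at M 1 ≡ᵇ_) ends) (≡ᵇ-refl (at M 1))

  enclosed : ∀ p q → 1 ≤ p → q ≤ suc m → ((1 <ᵇ p) ∨ (q <ᵇ suc m)) ≡ true →
    any (λ p' → any (λ q' → isClosed M p' q' ∧ ((p' <ᵇ p) ∨ (q <ᵇ q'))) (range q (suc m))) (range 1 p) ≡ true
  enclosed p q 1≤p q≤1+m e =
    trans (cong (any _) (range-one p)) (any-interval _ 1 p 1 ≤-refl (s≤s 1≤p)
      (trans (cong (any _) (range≡interval q (suc m)))
        (any-interval _ q (suc (suc m) ∸ q) (suc m) q≤1+m
          (subst (suc m <_) (sym (m+[n∸m]≡n (m≤n⇒m≤1+n q≤1+m))) ≤-refl)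
          (trans (cong (_∧ ((1 <ᵇ p) ∨ (q <ᵇ suc m))) whole-closed) e))))

  not-block : ∀ p q → 1 ≤ p → q ≤ suc m → ((1 <ᵇ p) ∨ (q <ᵇ suc m)) ≡ true → blockAt M (suc m) p q ≡ false
  not-block p q 1≤p q≤1+m e =
    trans (cong (λ z → isClosed M p q ∧ not z) (enclosed p q 1≤p q≤1+m e)) (∧-zeroʳ (isClosed M p q))

  whole-block : blockAt M (suc m) 1 (suc m) ≡ true
  whole-block rewrite range≡interval (suc m) (suc m) | m+n∸n≡m 1 m | whole-closed | <ᵇ-irrefl m = refl

  single : blocks M (suc m) ≡ 1
  single = trans (cong (λ z → sum (map (blocksFrom M (suc m)) z)) (range-one (suc m))) (cong₂ _+_ from-1 from-rest)
    where
    from-1 : blocksFrom M (suc m) 1 ≡ 1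
    from-1 = trans (cong (countB (blockAt M (suc m) 1)) (trans (range-one (suc m)) (interval-snoc 1 m)))
      (trans (countB-++ (blockAt M (suc m) 1) (interval 1 m) (suc m ∷ []))
      (cong₂ _+_ (countB-none (interval 1 m)
                    (interval-All 1 m (λ q _ q<1+m → not-block 1 q ≤-refl (m≤n⇒m≤1+n (≤-pred q<1+m)) (<ᵇ-true q<1+m))))
                 (cong (λ b → ind b + 0) whole-block)))
    from-rest : sum (map (blocksFrom M (suc m)) (interval 2 m)) ≡ 0
    from-rest = trans (cong sum (map-cong-local (interval-All 2 m (λ p 2≤p _ →
        countB-none (range p (suc m)) (range-All p (suc m) (λ q _ q≤1+m →
          not-block p q (≤-trans (s≤s z≤n) 2≤p) q≤1+m (cong (_∨ (q <ᵇ suc m)) (<ᵇ-true 2≤p))))))))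
      (sum-map-0 (interval 2 m))

at-++ˡ : ∀ u w i → i ≤ length u → at (u ++ w) i ≡ at u i
at-++ˡ u w zero _ = refl
at-++ˡ (x ∷ u) w (suc zero) _ = refl
at-++ˡ (x ∷ u) w (suc (suc i)) (s≤s i<|u|) = at-++ˡ u w (suc i) i<|u|

at-++ʳ : ∀ u w i → at (u ++ w) (length u + suc i) ≡ at w (suc i)
at-++ʳ [] w i = refl
at-++ʳ (x ∷ u) w i =
  trans (cong (λ z → at (x ∷ (u ++ w)) (suc z)) (+-suc (length u) i))
        (trans (cong (at (u ++ w)) (sym (+-suc (length u) i))) (at-++ʳ u w i))

cnt-at : ∀ σ i → 1 ≤ i → i ≤ length σ → 1 ≤ cnt (at σ i) σ
cnt-at (x ∷ σ) (suc zero) _ _ = subst (1 ≤_) (sym (cnt-head x σ)) (s≤s z≤n)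
cnt-at (x ∷ σ) (suc (suc i)) _ (s≤s i<|σ|) = ≤-trans (cnt-at σ (suc i) (s≤s z≤n) i<|σ|) (m≤n+m _ _)

blocks-++ : ∀ u w → Disjoint u w → Sn (u ++ w) ≡ Sn u + Sn w
blocks-++ u w sep =
  trans (cong (blocks (u ++ w)) (length-++ u))
        (Split.blocks-split (u ++ w) u w (length u) (length w) (λ i → at-++ˡ u w i) (at-++ʳ u w) apart)
  where
  apart : ∀ p q → 1 ≤ p → p ≤ length u → length u < q → q ≤ length u + length w →
          isClosed (u ++ w) p q ≡ false
  apart p q 1≤p p≤|u| |u|<q q≤|uw| = ≡ᵇ-false _ _ different
    where
    i = q ∸ suc (length u)
    q≡ : length u + suc i ≡ q
    q≡ = trans (+-suc (length u) i) (m+[n∸m]≡n |u|<q)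
    different : at (u ++ w) p ≡ at (u ++ w) q → ⊥
    different e with sep (at u p)
    ... | inj₁ z = <-irrefl (sym z) (cnt-at u p 1≤p p≤|u|)
    ... | inj₂ z = <-irrefl (sym z) (subst (λ y → 1 ≤ cnt y w)
          (trans (sym (at-++ʳ u w i)) (trans (cong (at (u ++ w)) q≡) (trans (sym e) (at-++ˡ u w p p≤|u|))))
          (cnt-at w (suc i) (s≤s z≤n) (+-cancelˡ-≤ (length u) _ _ (subst (_≤ length u + length w) (sym q≡) q≤|uw|))))

lastChild : {k m : ℕ} → Vec (Tree k) (suc m) → Tree k
lastChild (c ∷ []) = c
lastChild (c ∷ c' ∷ cs) = lastChild (c' ∷ cs)

middle : {k m : ℕ} → ℕ → Vec (Tree k) (suc m) → List ℕ
middle v (c ∷ []) = []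
middle v (c ∷ c' ∷ cs) = code c ++ v ∷ middle v (c' ∷ cs)

lblInit : {k m : ℕ} → Vec (Tree k) (suc m) → List ℕ
lblInit (c ∷ []) = []
lblInit (c ∷ c' ∷ cs) = lbl c ++ lblInit (c' ∷ cs)

codeV-split : {k m : ℕ} (v : ℕ) (cs : Vec (Tree k) (suc m)) → codeV v cs ≡ (v ∷ middle v cs) ++ code (lastChild cs)
codeV-split v (c ∷ []) = cong (v ∷_) (++-identityʳ (code c))
codeV-split v (c ∷ c' ∷ cs) =
  cong (v ∷_) (trans (cong (code c ++_) (codeV-split v (c' ∷ cs)))
                     (sym (++-assoc (code c) (v ∷ middle v (c' ∷ cs)) (code (lastChild (c' ∷ cs))))))

lblV-split : {k m : ℕ} (cs : Vec (Tree k) (suc m)) → lblV cs ≡ lblInit cs ++ lbl (lastChild cs)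
lblV-split (c ∷ []) = ++-identityʳ (lbl c)
lblV-split (c ∷ c' ∷ cs) =
  trans (cong (lbl c ++_) (lblV-split (c' ∷ cs)))
        (sym (++-assoc (lbl c) (lblInit (c' ∷ cs)) (lbl (lastChild (c' ∷ cs)))))

middle-ends : {k m : ℕ} (v : ℕ) (cs : Vec (Tree k) (suc m)) → at (v ∷ middle v cs) (suc (length (middle v cs))) ≡ v
middle-ends v (c ∷ []) = refl
middle-ends v (c ∷ c' ∷ cs) =
  trans (cong (λ z → at ((v ∷ code c) ++ (v ∷ middle v (c' ∷ cs))) (suc z)) (length-++ (code c)))
  (trans (at-++ʳ (v ∷ code c) (v ∷ middle v (c' ∷ cs)) (length (middle v (c' ∷ cs)))) (middle-ends v (c' ∷ cs)))

middle-0 : {k m : ℕ} (y v : ℕ) (cs : Vec (Tree k) (suc m)) → ind (v ≡ᵇ y) ≡ 0 → cnt y (lblInit cs) ≡ 0 →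
  cnt y (middle v cs) ≡ 0
middle-0 y v (c ∷ []) ev e = refl
middle-0 y v (c ∷ c' ∷ cs) ev e =
  cnt-++-0 y (code c) (v ∷ middle v (c' ∷ cs))
    (code-0 y c (cnt-++-0ˡ y (lbl c) (lblInit (c' ∷ cs)) e))
    (trans (cong (_+ cnt y (middle v (c' ∷ cs))) ev) (middle-0 y v (c' ∷ cs) ev (cnt-++-0ʳ y (lbl c) (lblInit (c' ∷ cs)) e)))

LRᵥ-last : {k' : ℕ} (i m : ℕ) (cs : Vec (Tree (suc k')) (suc m)) → 2 ≤ i → i + m ≡ suc (suc k') →
  LRᵥ {suc k'} i cs ≡ LR (lastChild cs)
LRᵥ-last {k'} i zero (c ∷ []) 2≤i e =
  trans (LRᵥ-cons i c [])
    (trans (cong (λ b → (if b then LR c else 0) + 0)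
                 (trans (cong (λ z → (z ≡ᵇ 1) ∨ (z ≡ᵇ suc (suc k'))) (trans (sym (+-identityʳ i)) e))
                        (cong ((suc k' ≡ᵇ 0) ∨_) (≡ᵇ-refl k'))))
           (+-identityʳ (LR c)))
LRᵥ-last {k'} i (suc m) (c ∷ c' ∷ cs) 2≤i e =
  trans (LRᵥ-cons i c (c' ∷ cs))
    (trans (cong (λ b → (if b then LR c else 0) + LRᵥ (suc i) (c' ∷ cs))
                 (cong₂ _∨_ (≡ᵇ-false-> 2≤i)
                            (≡ᵇ-false-< (subst (i <_) e (subst (i <_) (sym (+-suc i m)) (s≤s (m≤m+n i m)))))))
           (LRᵥ-last (suc i) m (c' ∷ cs) (m≤n⇒m≤1+n 2≤i) (trans (sym (+-suc i m)) e)))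

disjoint-codeV : ∀ {k m} A v (cs : Vec (Tree k) m) → Disjoint A (v ∷ lblV cs) → Disjoint A (codeV v cs)
disjoint-codeV A v cs s y with s y
... | inj₁ e = inj₁ e
... | inj₂ e = inj₂ (codeV-0 y v cs (m+n≡0⇒m≡0 (ind (v ≡ᵇ y)) e) (m+n≡0⇒n≡0 (ind (v ≡ᵇ y)) e))

disjoint-middle : ∀ {k m} B v (cs : Vec (Tree k) (suc m)) → Disjoint (v ∷ lblInit cs) B → Disjoint (v ∷ middle v cs) B
disjoint-middle B v cs s y with s y
... | inj₂ e = inj₂ e
... | inj₁ e = inj₁ (cong₂ _+_ v≢y (middle-0 y v cs v≢y (m+n≡0⇒n≡0 (ind (v ≡ᵇ y)) e)))
  where
  v≢y = m+n≡0⇒m≡0 (ind (v ≡ᵇ y)) e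

module DistinctNode {k : ℕ} (v : ℕ) (c : Tree (suc k)) (cs : Vec (Tree (suc k)) (suc k))
  (d : Distinct (lbl (node v (c ∷ cs)))) where

  below : Distinct (lbl c ++ lblV cs)
  below = distinct-tail v (lbl c ++ lblV cs) d

  first : Distinct (lbl c)
  first = distinct-++ˡ (lbl c) (lblV cs) below

  rest : Distinct (lblInit cs ++ lbl (lastChild cs))
  rest = subst Distinct (lblV-split cs) (distinct-++ʳ (lbl c) (lblV cs) below)

  last : Distinct (lbl (lastChild cs))
  last = distinct-++ʳ (lblInit cs) (lbl (lastChild cs)) rest

  v∉ : cnt v (lbl c ++ lblV cs) ≡ 0
  v∉ = distinct-head v (lbl c ++ lblV cs) d

  v∉last : cnt v (lbl (lastChild cs)) ≡ 0
  v∉last = cnt-++-0ʳ v (lblInit cs) (lbl (lastChild cs))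
             (subst (λ z → cnt v z ≡ 0) (lblV-split cs) (cnt-++-0ʳ v (lbl c) (lblV cs) v∉))

  first-apart : Disjoint (code c) ((v ∷ middle v cs) ++ code (lastChild cs))
  first-apart = subst (Disjoint (code c)) (codeV-split v cs)
    (disjoint-sym (codeV v cs) (code c) (disjoint-code (codeV v cs) c (disjoint-sym (lbl c) (codeV v cs)
      (disjoint-codeV (lbl c) v cs
        (disjoint-∷ v (lbl c) (lblV cs) (cnt-++-0ˡ v (lbl c) (lblV cs) v∉)
          (distinct-++⇒disjoint (lbl c) (lblV cs) below))))))

  last-apart : Disjoint (v ∷ middle v cs) (code (lastChild cs))
  last-apart = disjoint-code (v ∷ middle v cs) (lastChild cs)
    (disjoint-middle (lbl (lastChild cs)) v cs
      (disjoint-sym (lbl (lastChild cs)) (v ∷ lblInit cs)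
        (disjoint-∷ v (lbl (lastChild cs)) (lblInit cs) v∉last
          (disjoint-sym (lblInit cs) (lbl (lastChild cs)) (distinct-++⇒disjoint (lblInit cs) (lbl (lastChild cs)) rest)))))

-- Blocks of code τ are the left-right nodes of τ: the first and last
-- subtrees contribute their blocks, the middle part v ⋯ v is one block.
mutual
  blocks-code : {k' : ℕ} (t : Tree (suc k')) → Distinct (lbl t) → Sn (code t) ≡ LR t
  blocks-code leaf d = refl
  blocks-code {k'} (node v (c ∷ cs)) d = begin
    Sn (code c ++ codeV v cs)
      ≡⟨ cong (λ z → Sn (code c ++ z)) (codeV-split v cs) ⟩
    Sn (code c ++ (v ∷ middle v cs) ++ code (lastChild cs))
      ≡⟨ blocks-++ (code c) ((v ∷ middle v cs) ++ code (lastChild cs)) first-apart ⟩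
    Sn (code c) + Sn ((v ∷ middle v cs) ++ code (lastChild cs))
      ≡⟨ cong (Sn (code c) +_) (blocks-++ (v ∷ middle v cs) (code (lastChild cs)) last-apart) ⟩
    Sn (code c) + (Sn (v ∷ middle v cs) + Sn (code (lastChild cs)))
      ≡⟨ cong₂ (λ a b → a + (b + Sn (code (lastChild cs))))
               (blocks-code c first) (SingleBlock.single (v ∷ middle v cs) (length (middle v cs)) (middle-ends v cs)) ⟩
    LR c + suc (Sn (code (lastChild cs)))
      ≡⟨ cong (λ z → LR c + suc z) (blocks-lastChild cs last) ⟩
    LR c + suc (LR (lastChild cs))
      ≡⟨ +-suc (LR c) (LR (lastChild cs)) ⟩
    suc (LR c + LR (lastChild cs))
      ≡⟨ cong suc (sym (trans (LRᵥ-cons 1 c cs) (cong (LR c +_) (LRᵥ-last 2 k' cs (s≤s (s≤s z≤n)) refl)))) ⟩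
    LR (node v (c ∷ cs)) ∎
    where
    open ≡-Reasoning
    open DistinctNode v c cs d

  blocks-lastChild : {k' m : ℕ} (cs : Vec (Tree (suc k')) (suc m)) → Distinct (lbl (lastChild cs)) →
    Sn (code (lastChild cs)) ≡ LR (lastChild cs)
  blocks-lastChild (c ∷ []) d = blocks-code c d
  blocks-lastChild (c ∷ c' ∷ cs) d = blocks-lastChild (c' ∷ cs) d

ChildrenAbove : {k : ℕ} → Vertex k → Set
ChildrenAbove x = let (p , v , cs) = x in All (v <_) (childLabels cs)

rootAbove : {k : ℕ} → ℕ → Tree k → Set
rootAbove lo leaf = ⊤
rootAbove lo (node v _) = lo < v

mutual
  increasing⇒above : {k : ℕ} (lo : ℕ) (t : Tree k) → rootAbove lo t → All ChildrenAbove (vertices t) → IncAbove lo t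
  increasing⇒above lo leaf _ _ = tt
  increasing⇒above lo (node v cs) lo<v (here ∷ below) = lo<v , increasing⇒aboveᵥ v 1 cs here below

  increasing⇒aboveᵥ : {k m : ℕ} (v i : ℕ) (cs : Vec (Tree k) m) →
    All (v <_) (childLabels cs) → All ChildrenAbove (verticesV i cs) → IncAboveV v cs
  increasing⇒aboveᵥ v i [] _ _ = tt
  increasing⇒aboveᵥ v i (leaf ∷ cs) here below = tt , increasing⇒aboveᵥ v (suc i) cs here below
  increasing⇒aboveᵥ v i (node w ds ∷ cs) (v<w ∷ here) below =
    increasing⇒above v (node w ds) v<w (All.map⁻ (All.++⁻ˡ (map (prepend i) (vertices (node w ds))) below)) ,
    increasing⇒aboveᵥ v (suc i) cs here (All.++⁻ʳ (map (prepend i) (vertices (node w ds))) below)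

cnt-interval-below : ∀ y lo d → y < lo → cnt y (interval lo d) ≡ 0
cnt-interval-below y lo zero y<lo = refl
cnt-interval-below y lo (suc d) y<lo =
  cong₂ _+_ (cong ind (≡ᵇ-false-> y<lo)) (cnt-interval-below y (suc lo) d (m≤n⇒m≤1+n y<lo))

interval-distinct : ∀ lo d → Distinct (interval lo d)
interval-distinct lo zero y = z≤n
interval-distinct lo (suc d) y with lo ≡ᵇ y in eq
... | true = s≤s (≤-reflexive (cnt-interval-below y (suc lo) d (s≤s (≤-reflexive (sym (≡ᵇ-sound lo y eq))))))
... | false = interval-distinct (suc lo) d y

record Increasing {k : ℕ} (τ : Tree k) : Set where
  field
    distinct : Distinct (lbl τ)
    positive : cnt 0 (lbl τ) ≡ 0
    above-0 : IncAbove 0 τ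

module _ {k n : ℕ} {τ : Tree k} (inc : IsIncreasingTree k n τ) where

  private
    labels↭ : lbl τ ↭ interval 1 n
    labels↭ = subst₂ _↭_ (labels≡lbl τ) (range-one n) (proj₁ inc)

  increasing : Increasing τ
  increasing = record
    { distinct = λ y → subst (_≤ 1) (sym (countB-↭ (λ x → x ≡ᵇ y) labels↭)) (interval-distinct 1 n y)
    ; positive = trans (countB-↭ (λ x → x ≡ᵇ 0) labels↭) (cnt-interval-below 0 1 n (s≤s z≤n))
    ; above-0 = increasing⇒above 0 τ (root-positive τ (proj₁ (proj₂ inc))) (proj₂ (proj₂ inc))
    }
    where
    root-positive : (t : Tree k) → rootLabel t ≡ 1 → rootAbove 0 t
    root-positive leaf _ = tt
    root-positive (node v cs) refl = s≤s z≤n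

  increasing-size : size τ ≡ n
  increasing-size =
    trans (sym (length-map label (vertices τ)))
      (trans (↭-length (proj₁ inc)) (trans (cong length (range-one n)) (interval-length 1 n)))

pairs-of-code : {k : ℕ} (t : Tree k) → Distinct (lbl t) → (Q : Ann × Ann → Bool) →
  countB (Q ∘ pairAt [] (code t)) (interval 1 (length (code t))) ≡ countB Q (adjacent (annCode t) (0 , cnt 0 (code t)))
pairs-of-code t d Q =
  trans (sym (countB-map Q (pairAt [] (code t)) (interval 1 (length (code t)))))
  (cong (countB Q) (trans (pairs-annFrom [] (code t))
                          (cong (λ z → adjacent z (0 , cnt 0 (code t))) (annFrom-code t [] d (λ y → inj₂ refl)))))

at-beyond : ∀ σ i → length σ < i → at σ i ≡ 0
at-beyond [] zero _ = refl
at-beyond [] (suc i) _ = refl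
at-beyond (x ∷ σ) (suc (suc i)) (s≤s |σ|<i) = at-beyond σ (suc i) |σ|<i

occ-sentinel : ∀ σ → cnt 0 σ ≡ 0 → occ σ (suc (length σ)) ≡ 0
occ-sentinel σ z =
  trans (cong (countB (λ x → x ≡ᵇ at σ (suc (length σ)))) (take-all (suc (length σ)) σ (n≤1+n (length σ))))
        (trans (cong (λ a → cnt a σ) (at-beyond σ (suc (length σ)) ≤-refl)) z)

-- hence the guard i < |σ| in the definition of j-descents is automatic
descent-guard : ∀ σ J i → cnt 0 σ ≡ 0 → i ≤ length σ →
  ((i <ᵇ length σ) ∧ (isDesc σ i ∧ (occ σ (suc i) ≡ᵇ suc J))) ≡ (isDesc σ i ∧ (occ σ (suc i) ≡ᵇ suc J))
descent-guard σ J i z i≤|σ| with m≤n⇒m<n∨m≡n i≤|σ|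
... | inj₁ i<|σ| rewrite <ᵇ-true i<|σ| = refl
... | inj₂ refl =
  trans (cong (_∧ (isDesc σ (length σ) ∧ (occ σ (suc (length σ)) ≡ᵇ suc J))) (<ᵇ-irrefl (length σ)))
        (sym (trans (cong (λ o → isDesc σ (length σ) ∧ (o ≡ᵇ suc J)) (occ-sentinel σ z)) (∧-zeroʳ _)))

first-letter-positive : ∀ σ → cnt 0 σ ≡ 0 → 1 ≤ length σ → ∃ λ x → at σ 1 ≡ suc x
first-letter-positive (suc x ∷ σ) _ _ = x , refl

code-nonempty : {k' : ℕ} (v : ℕ) (cs : Vec (Tree (suc k')) (suc (suc k'))) → 1 ≤ length (code (node v cs))
code-nonempty v (c ∷ c' ∷ cs) =
  subst (1 ≤_) (sym (length-++ (code c))) (≤-trans (s≤s z≤n) (m≤n+m (suc (length (code c' ++ codeV v cs))) (length (code c))))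

complement : ∀ {a b n} → a + b ≡ n → a ≡ n ∸ b
complement {a} {b} e = sym (trans (cong (_∸ b) (sym e)) (m+n∸n≡m a b))

module CodeStatistics {k' : ℕ} (v : ℕ) (cs : Vec (Tree (suc k')) (suc (suc k'))) (inc : Increasing (node v cs)) where

  open Increasing inc

  τ : Tree (suc k')
  τ = node v cs

  σ : List ℕ
  σ = code τ

  sentinel : Ann
  sentinel = (0 , cnt 0 σ)

  -- labels are positive, so σ has no letter 0
  no-0 : cnt 0 σ ≡ 0
  no-0 = code-0 0 τ positive

  transfer : (Q : Ann × Ann → Bool) →
    countB (Q ∘ pairAt [] σ) (range 1 (length σ)) ≡ countB Q (adjacent (annCode τ) sentinel)
  transfer Q = trans (cong (countB (Q ∘ pairAt [] σ)) (range-one (length σ))) (pairs-of-code τ distinct Q)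

  j-ascents : ∀ J → Xnj σ (suc J) ≡ D τ (suc (suc J))
  j-ascents J = trans (transfer (ascentAt (suc J))) (ascents-code J τ sentinel above-0)

  -- the sentinel has occurrence number 0, so the last pair is no j-descent
  j-descents : ∀ J → J ≤ k' → Ynj σ (suc J) ≡ D τ (suc J)
  j-descents J J≤k' =
    trans (countB-cong-local (range 1 (length σ)) (range-All 1 (length σ) (λ i _ i≤|σ| → descent-guard σ J i no-0 i≤|σ|)))
    (trans (transfer (descentAt (suc J)))
    (trans (descents-code J J≤k' τ sentinel above-0)
    (trans (cong (λ z → D τ (suc J) + ind (isNode τ ∧ (z ≡ᵇ suc J))) no-0)
    (trans (cong (λ b → D τ (suc J) + ind b) (∧-zeroʳ (isNode τ))) (+-identityʳ _)))))

  j-plateaux : ∀ J → suc J ≤ k' → Znj σ (suc J) ≡ L τ (suc (suc J))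
  j-plateaux J J<k' = trans (transfer (plateauAt (suc J))) (plateaus-code J J<k' τ sentinel above-0)

  -- index 0 is an ascent and not a plateau, since a₁ > 0
  index-0 : ∃ λ x → at σ 1 ≡ suc x
  index-0 = first-letter-positive σ no-0 (code-nonempty v cs)

  all-ascents : Xn σ + D τ 1 ≡ size τ
  all-ascents = begin
    Xn σ + D τ 1
      ≡⟨ cong (λ z → countB (isAsc σ) z + D τ 1) (range≡interval 0 (length σ)) ⟩
    ind (0 <ᵇ at σ 1) + countB (isAsc σ) (interval 1 (length σ)) + D τ 1
      ≡⟨ cong (λ z → ind (0 <ᵇ at σ 1) + z + D τ 1) (pairs-of-code τ distinct ascent) ⟩
    ind (0 <ᵇ at σ 1) + countB ascent (adjacent (annCode τ) sentinel) + D τ 1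
      ≡⟨ cong (λ a → ind (0 <ᵇ a) + countB ascent (adjacent (annCode τ) sentinel) + D τ 1) (proj₂ index-0) ⟩
    suc (countB ascent (adjacent (annCode τ) sentinel) + D τ 1)
      ≡⟨ +-comm 1 _ ⟩
    countB ascent (adjacent (annCode τ) sentinel) + D τ 1 + 1
      ≡⟨ ascents-total τ _ above-0 ⟩
    size τ ∎
    where open ≡-Reasoning

  all-descents : Yn σ + D τ (suc (suc k')) ≡ size τ
  all-descents =
    trans (cong (λ z → countB (isDesc σ) z + D τ (suc (suc k'))) (range≡interval 0 (length σ)))
    (trans (cong (_+ D τ (suc (suc k'))) (pairs-of-code τ distinct descent))
           (descents-total τ sentinel above-0))

  all-plateaux : Zn σ ≡ sum (map (L τ) (range 2 (suc k')))
  all-plateaux =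
    trans (cong (countB (isPlat σ)) (range≡interval 0 (length σ)))
    (trans (cong (λ a → ind (0 ≡ᵇ a) + countB (isPlat σ) (interval 1 (length σ))) (proj₂ index-0))
    (trans (cong (ind (0 ≡ᵇ suc (proj₁ index-0)) +_) (pairs-of-code τ distinct plateau))
    (trans (plateaus-total τ sentinel above-0) (cong (λ z → sum (map (L τ) z)) (sym (range≡interval 2 (suc k')))))))

theorem3p4 : (k n : ℕ) → 1 ≤ k → 1 ≤ n →
    (τ : Tree k) → IsIncreasingTree k n τ →
    ((j : ℕ) → 1 ≤ j → j ≤ k → Xnj (Φ τ) j ≡ D τ (suc j)) ×
    ((j : ℕ) → 1 ≤ j → j ≤ k → Ynj (Φ τ) j ≡ D τ j) ×
    ((j : ℕ) → 1 ≤ j → j ≤ k ∸ 1 →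
       (Znj (Φ τ) j ≡ L τ (suc j)) × (L τ (suc j) ≡ n ∸ D τ (suc j))) ×
    ((Xn (Φ τ) ≡ n ∸ D τ 1) × (n ∸ D τ 1 ≡ L τ 1)) ×
    ((Yn (Φ τ) ≡ n ∸ D τ (suc k)) × (n ∸ D τ (suc k) ≡ L τ (suc k))) ×
    (Zn (Φ τ) ≡ sum (map (L τ) (range 2 k))) ×
    (Sn (Φ τ) ≡ LR τ)
theorem3p4 (suc k') n _ _ leaf (_ , () , _)
theorem3p4 (suc k') n _ _ (node v cs) inc =
  (λ { (suc J) _ _ → j-ascents J }) ,
  (λ { (suc J) _ (s≤s J≤k') → j-descents J J≤k' }) ,
  (λ { (suc J) _ J<k' → j-plateaux J J<k' , L≡n∸D (suc J) (m≤n⇒m≤1+n J<k') }) ,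
  (complement (trans all-ascents size≡n) , sym (L≡n∸D 0 z≤n)) ,
  (complement (trans all-descents size≡n) , sym (L≡n∸D (suc k') ≤-refl)) ,
  all-plateaux ,
  blocks-code (node v cs) (Increasing.distinct (increasing inc))
  where
  open CodeStatistics v cs (increasing inc)
  size≡n = increasing-size inc
  L≡n∸D : ∀ j → j ≤ suc k' → L (node v cs) (suc j) ≡ n ∸ D (node v cs) (suc j)
  L≡n∸D j j≤k = complement (trans (empty+occupied j j≤k (node v cs)) size≡n)
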